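{- For any integer $\ell\geq 4$, $z_{\ell, \ell} = |Z(\ell)|\,2^{\ell}/ (4\ell)$. In particular, $z_{\ell, \ell} \leq (2\ell)! /(4\ell)$.
   Context: $Q_\ell$ denotes the $\ell$-dimensional hypercube: its vertices are the binary vectors of length $\ell$, two vectors being adjacent iff they differ in exactly one coordinate (the flip coordinate of the edge). $C_m$ is the cycle on $m$ vertices. $z_{\ell,\ell}$ denotes the number of subgraphs of $Q_\ell$ isomorphic to $C_{2\ell}$ whose edges together use all $\ell$ coordinates as flip coordinates. $Z(\ell)$ is the set of words (sequences) of length $2\ell$ over the alphabet $\{1,\dots,\ell\}$ in which each symbol appears exactly twice and such that, for every $1\le k<\ell$, no interval of $2k$ consecutive positions of the word contains each symbol an even number of times. -}

module Defs where

open import Data.Bool using (Bool; true; false; not)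
import Data.Bool as Bool
open import Data.Nat using (ℕ; zero; suc; _+_; _*_; _≤_; _≤?_)
open import Data.Nat.Divisibility using (_∣_; _∣?_)
open import Data.Fin using (Fin; toℕ)
import Data.Fin as Fin
import Data.Fin.Properties as FinP
open import Data.Fin.Subset.Properties using (anySubset?)
open import Data.Vec using (Vec; []; _∷_; lookup; updateAt; toList)
import Data.Vec as Vec
import Data.Vec.Properties as VecP
open import Data.List using (List; []; _∷_; _++_; _∷ʳ_; zip; map; concatMap; filter; length; take; drop; allFin)
import Data.List as List
open import Data.List.Relation.Unary.All using (All; all?)
open import Data.List.Relation.Unary.Any using (Any; any?)
open import Data.List.Relation.Unary.Unique.Propositional using (Unique)
open import Data.List.Relation.Unary.Unique.DecPropositional using (unique?)
open import Data.Product using (Σ; ∃; _×_; _,_; proj₁; proj₂)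
open import Data.Sum using (_⊎_)
open import Relation.Binary.PropositionalEquality using (_≡_; refl)
open import Relation.Binary.Definitions using (DecidableEquality)
open import Relation.Nullary using (Dec; yes; no; ¬_; ¬?)
open import Relation.Nullary.Decidable using (_×-dec_; _⊎-dec_; _→-dec_; map′)
open import Relation.Unary using (Decidable)

vecsOver : ∀ {A : Set} → List A → (n : ℕ) → List (Vec A n)
vecsOver xs zero    = [] ∷ []
vecsOver xs (suc n) = concatMap (λ x → map (x ∷_) (vecsOver xs n)) xs

-- all sublists (= subsets, for a duplicate-free list) of a list
subsets : ∀ {A : Set} → List A → List (List A)
subsets []       = [] ∷ []
subsets (x ∷ xs) = subsets xs ++ map (x ∷_) (subsets xs)

∃vec? : ∀ {A : Set} →
        (∀ {P : A → Set} → Decidable P → Dec (∃ P)) →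
        ∀ m {P : Vec A m → Set} → Decidable P → Dec (∃ P)
∃vec? search zero    P? with P? []
... | yes p = yes ([] , p)
... | no ¬p = no λ { ([] , p) → ¬p p }
∃vec? search (suc m) {P} P? =
  map′ (λ { (x , xs , p) → (x ∷ xs) , p })
       (λ { ((x ∷ xs) , p) → x , xs , p })
       (search (λ x → ∃vec? search m (λ xs → P? (x ∷ xs))))

Vtx : ℕ → Set
Vtx ℓ = Vec Bool ℓ

_≟V_ : ∀ {ℓ} → DecidableEquality (Vtx ℓ)
_≟V_ = VecP.≡-dec Bool._≟_

allVtx : (ℓ : ℕ) → List (Vtx ℓ)
allVtx ℓ = vecsOver (true ∷ false ∷ []) ℓ

flipAt : ∀ {ℓ} → Fin ℓ → Vtx ℓ → Vtx ℓ
flipAt i v = updateAt v i not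

-- an edge of Q_ℓ is represented (uniquely) by its endpoint v having a 0
-- in the flip coordinate i; the other endpoint is flipAt i v
Edge : ℕ → Set
Edge ℓ = Vtx ℓ × Fin ℓ

edgesQ : (ℓ : ℕ) → List (Edge ℓ)
edgesQ ℓ = filter (λ e → lookup (proj₁ e) (proj₂ e) Bool.≟ false)
                  (List.cartesianProduct (allVtx ℓ) (allFin ℓ))

Joins : ∀ {ℓ} → Edge ℓ → Vtx ℓ → Vtx ℓ → Set
Joins (v , i) u w = (u ≡ v × w ≡ flipAt i v) ⊎ (w ≡ v × u ≡ flipAt i v)

joins? : ∀ {ℓ} (e : Edge ℓ) u w → Dec (Joins e u w)
joins? (v , i) u w = ((u ≟V v) ×-dec (w ≟V flipAt i v))
                  ⊎-dec ((w ≟V v) ×-dec (u ≟V flipAt i v))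

cycPairs : ∀ {A : Set} → List A → List (A × A)
cycPairs []       = []
cycPairs (x ∷ xs) = zip (x ∷ xs) (xs ∷ʳ x)

-- The edge set S (a subgraph of Q_ℓ without isolated vertices, given by
-- its edges) forms a cycle C_m: there are m pairwise distinct vertices
-- w₀,…,w_{m-1} such that the edges of S are exactly the edges
-- w₀w₁, w₁w₂, …, w_{m-1}w₀.
IsCycleWalk : ∀ {ℓ} (m : ℕ) → List (Edge ℓ) → Vec (Vtx ℓ) m → Set
IsCycleWalk m S w =
  Unique (toList w)
  × All (λ p → Any (λ e → Joins e (proj₁ p) (proj₂ p)) S) (cycPairs (toList w))
  × All (λ e → Any (λ p → Joins e (proj₁ p) (proj₂ p)) (cycPairs (toList w))) S

IsCycle : ∀ {ℓ} (m : ℕ) → List (Edge ℓ) → Set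
IsCycle {ℓ} m S = 3 ≤ m × ∃ λ (w : Vec (Vtx ℓ) m) → IsCycleWalk m S w

isCycleWalk? : ∀ {ℓ} m (S : List (Edge ℓ)) → Decidable (IsCycleWalk m S)
isCycleWalk? m S w =
  unique? _≟V_ (toList w)
  ×-dec all? (λ p → any? (λ e → joins? e (proj₁ p) (proj₂ p)) S) (cycPairs (toList w))
  ×-dec all? (λ e → any? (λ p → joins? e (proj₁ p) (proj₂ p)) (cycPairs (toList w))) S

isCycle? : ∀ {ℓ} m → Decidable (IsCycle {ℓ} m)
isCycle? m S = (3 ≤? m) ×-dec ∃vec? anySubset? m (isCycleWalk? m S)

UsesAllCoords : ∀ {ℓ} → List (Edge ℓ) → Set
UsesAllCoords {ℓ} S = (i : Fin ℓ) → Any (λ e → proj₂ e ≡ i) S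

usesAllCoords? : ∀ {ℓ} → Decidable (UsesAllCoords {ℓ})
usesAllCoords? S = FinP.all? (λ i → any? (λ e → proj₂ e FinP.≟ i) S)

-- z_{ℓ,ℓ}: number of subgraphs of Q_ℓ isomorphic to C_{2ℓ} using all ℓ
-- coordinates as flip coordinates (a cycle subgraph is determined by
-- its edge set, a subset of the edges of Q_ℓ)
zℓℓ : ℕ → ℕ
zℓℓ ℓ = length (filter (λ S → isCycle? (2 * ℓ) S ×-dec usesAllCoords? S)
                       (subsets (edgesQ ℓ)))

Word : ℕ → Set
Word ℓ = Vec (Fin ℓ) (2 * ℓ)

occ : ∀ {ℓ} → Fin ℓ → List (Fin ℓ) → ℕ
occ a xs = length (filter (FinP._≟ a) xs)

EachTwice : ∀ {ℓ} → Word ℓ → Set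
EachTwice {ℓ} w = (a : Fin ℓ) → occ a (toList w) ≡ 2

AllEven : ∀ {ℓ} → List (Fin ℓ) → Set
AllEven {ℓ} xs = (a : Fin ℓ) → 2 ∣ occ a xs

-- for every 1 ≤ k < ℓ, no interval of 2k consecutive positions
-- (positions s, …, s+2k-1 with s + 2k ≤ 2ℓ) has all symbols even
NoEvenInterval : ∀ {ℓ} → Word ℓ → Set
NoEvenInterval {ℓ} w =
  (k : Fin ℓ) (s : Fin (suc (2 * ℓ))) →
  1 ≤ toℕ k → toℕ s + 2 * toℕ k ≤ 2 * ℓ →
  ¬ AllEven (take (2 * toℕ k) (drop (toℕ s) (toList w)))

InZ : ∀ {ℓ} → Word ℓ → Set
InZ w = EachTwice w × NoEvenInterval w

inZ? : ∀ {ℓ} → Decidable (InZ {ℓ})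
inZ? {ℓ} w =
  FinP.all? (λ a → occ a (toList w) Data.Nat.≟ 2)
  ×-dec FinP.all? (λ k → FinP.all? (λ s →
          (1 ≤? toℕ k) →-dec (toℕ s + 2 * toℕ k ≤? 2 * ℓ) →-dec
          ¬? (FinP.all? (λ a → 2 ∣? occ a (take (2 * toℕ k) (drop (toℕ s) (toList w)))))))

-- |Z(ℓ)|, counted over the list of all words of length 2ℓ over {1..ℓ}
-- (here the symbols are Fin ℓ = {0..ℓ-1})
cardZ : ℕ → ℕ
cardZ ℓ = length (filter inZ? (vecsOver (allFin ℓ) (2 * ℓ)))

-- Reading a word w ∈ Z(ℓ) from a vertex v of Q_ℓ as a sequence of flip coordinates gives a
-- closed walk of length 2ℓ, since every coordinate is flipped twice.  It visits no vertex twice,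
-- because returning early would produce an interval of length 2k < 2ℓ in which every symbol occurs
-- evenly often; so it runs around a 2ℓ-cycle using all ℓ coordinates.  Conversely each such cycle
-- is traversed by exactly 4ℓ pairs (v, w): one for each starting vertex and each direction.
-- Counting the pairs in both ways gives 4ℓ z_{ℓ,ℓ} = 2^ℓ |Z(ℓ)|.  The bound follows because
-- only (2ℓ)! / 2^ℓ words contain each of ℓ symbols exactly twice.

module Submission where

open import Defs
open import Data.Bool using (Bool; true; false; not; if_then_else_)
import Data.Bool as Bool
open import Data.Bool.Properties using (not-involutive; not-¬)
open import Data.Empty using (⊥; ⊥-elim)
open import Data.Fin using (Fin; zero; suc; toℕ; fromℕ<; punchIn)
open import Data.Fin.Properties using (_≟_; all?; suc-injective; punchInᵢ≢i; toℕ-fromℕ<; toℕ-injective; toℕ<n)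
open import Data.List using (List; []; _∷_; _++_; _∷ʳ_; zip; take; drop; map; concatMap; filter; length; applyUpTo; allFin; cartesianProduct; cartesianProductWith)
import Data.List as List
open import Data.List.Membership.Propositional using (_∈_; find; lose)
open import Data.List.Membership.Propositional.Properties
  using (∈-++⁺ˡ; ∈-++⁺ʳ; ∈-++⁻; ∈-map⁺; ∈-map⁻; ∈-filter⁺; ∈-filter⁻; ∈-applyUpTo⁺; ∈-applyUpTo⁻; ∈-allFin;
         ∈-cartesianProductWith⁺; ∈-cartesianProduct⁺; ∈-cartesianProduct⁻)
open import Data.List.Membership.Propositional.Properties.WithK using (unique∧set⇒bag)
open import Data.List.Properties
  using (length-++; length-map; map-cong; map-tabulate; applyUpTo-∷ʳ; length-applyUpTo; filter-++; filter-≐; filter-none; filter-accept; filter-reject)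
open import Data.List.Relation.Binary.BagAndSetEquality using (∼bag⇒↭)
open import Data.List.Relation.Binary.Permutation.Propositional.Properties using (↭-length)
open import Data.List.Relation.Binary.Sublist.Propositional using (⊆-refl)
open import Data.List.Relation.Binary.Sublist.Propositional.Properties using (filter⁺; length-mono-≤)
open import Data.List.Relation.Unary.All using (All; universal)
import Data.List.Relation.Unary.All as All
import Data.List.Relation.Unary.All.Properties as All
open import Data.List.Relation.Unary.AllPairs using ([]; _∷_)
import Data.List.Relation.Unary.AllPairs as AllPairs
open import Data.List.Relation.Unary.Any using (Any; any?; here; there)
import Data.List.Relation.Unary.Any as Any
import Data.List.Relation.Unary.Any.Properties as Any
open import Data.List.Relation.Unary.Unique.Propositional using (Unique)
import Data.List.Relation.Unary.Unique.Propositional.Properties as Unique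
open import Data.Maybe using (Maybe; just; nothing; fromMaybe)
import Data.Maybe as Maybe
import Data.Nat as ℕ
open import Data.Nat using (ℕ; zero; suc; pred; _+_; _*_; _^_; _∸_; _≤_; _<_; _!; _%_; z≤n; s≤s; >-nonZero)
open import Data.Nat.DivMod using (_mod_; m%n<n; m%n%n≡m%n; [m+n]%n≡m%n; [m+kn]%n≡m%n; m<n⇒m%n≡m; %-distribˡ-+; %-distribˡ-*)
open import Data.Nat.Divisibility using (_∣_; divides; _∣0; ∣-refl; ∣m∣n⇒∣m+n)
open import Data.Nat.GeneralisedArithmetic using (iterate)
open import Data.Nat.ListAction using (sum)
open import Data.Nat.Properties
  using (module ≤-Reasoning; +-*-semiring; *-1-commutativeMonoid; +-commutativeSemigroup;
         +-assoc; +-comm; +-identityʳ; +-suc; *-assoc; *-comm; *-identityʳ; *-zeroʳ; *-distribʳ-+;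
         +-cancelˡ-≤; +-cancelʳ-≤; *-cancelˡ-≡; *-cancelˡ-<;
         +-mono-≤; +-monoˡ-≤; +-monoʳ-≤; *-monoˡ-≤; *-monoʳ-≤; ∸-monoˡ-≤;
         ≤-refl; ≤-reflexive; ≤-trans; ≤-antisym; <-trans; ≤-<-trans; <-cmp; <⇒≤; <⇒≢; n<1+n; n≢0⇒n>0; suc-pred;
         m≤m+n; m<m+n; m∸n≤m; m+n∸m≡n; m+[n∸m]≡n; m<n⇒0<n∸m; m≤n⇒m<n∨m≡n)
open import Data.Nat.Solver using (module +-*-Solver)
open import Algebra.Properties.CommutativeSemigroup +-commutativeSemigroup using () renaming (interchange to +-interchange)
open import Algebra.Properties.CommutativeMonoid.Sum *-1-commutativeMonoid
  using () renaming (sum to ∏; sum-remove to ∏-remove; sum-cong-≗ to ∏-cong-≗; sum-replicate-zero to ∏-replicate-1)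
open import Algebra.Properties.Semiring.Sum +-*-semiring
  using (∑-distrib-+)
  renaming (sum to ∑; sum-remove to ∑-remove; sum-cong-≗ to ∑-cong-≗; sum-replicate-zero to ∑-replicate-0; *-distribʳ-sum to *-distribʳ-∑)
open import Data.Product using (_×_; _,_; proj₁; proj₂; ∃)
open import Data.Sum using (_⊎_; inj₁; inj₂; [_,_]′)
open import Data.Vec using (Vec; []; _∷_; lookup; toList; tabulate)
open import Data.Vec.Functional using (updateAt; removeAt)
open import Data.Vec.Functional.Properties using (updateAt-updates; updateAt-minimal)
open import Data.Vec.Properties
  using (∷-injective; lookup∘updateAt; lookup∘updateAt′; updateAt-updateAt; updateAt-id-local; tabulate∘lookup; tabulate-cong; lookup∘tabulate)
open import Function using (_∘_; flip)
open import Function.Bundles using (mk⇔)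
open import Relation.Binary.Definitions using (tri<; tri≈; tri>)
open import Relation.Binary.PropositionalEquality hiding ([_])
open import Relation.Nullary using (¬_; Dec; yes; no; does)
open import Relation.Nullary.Decidable using (_×-dec_)
open import Relation.Unary using (Decidable; _⊆_)

unique∧set⇒length≡ : ∀ {A : Set} {xs ys : List A} → Unique xs → Unique ys →
                     (∀ {x} → x ∈ xs → x ∈ ys) → (∀ {x} → x ∈ ys → x ∈ xs) →
                     length xs ≡ length ys
unique∧set⇒length≡ ux uy f g = ↭-length (∼bag⇒↭ (unique∧set⇒bag ux uy (mk⇔ f g)))

length-filter-mono : ∀ {A : Set} {P Q : A → Set} (P? : Decidable P) (Q? : Decidable Q) →
                     P ⊆ Q → ∀ xs → length (filter P? xs) ≤ length (filter Q? xs)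
length-filter-mono P? Q? P⊆Q xs = length-mono-≤ (filter⁺ P? Q? (λ { refl → P⊆Q }) (⊆-refl {x = xs}))

sum-map-const : ∀ {A : Set} {f : A → ℕ} {c} xs → (∀ {x} → x ∈ xs → f x ≡ c) →
                sum (map f xs) ≡ length xs * c
sum-map-const []       _  = refl
sum-map-const (x ∷ xs) fc = cong₂ _+_ (fc (here refl)) (sum-map-const xs (fc ∘ there))

module _ {A B : Set} {R : A → B → Set} (R? : ∀ x y → Dec (R x y)) where

  private
    [_] : ∀ {P : Set} → Dec P → ℕ
    [ yes _ ] = 1
    [ no  _ ] = 0

    length-filter-∷ : ∀ {P : A → Set} (P? : Decidable P) x xs →
                      length (filter P? (x ∷ xs)) ≡ [ P? x ] + length (filter P? xs)
    length-filter-∷ P? x xs with P? x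
    ... | yes _ = refl
    ... | no  _ = refl

    length-filter-as-sum : ∀ x ys → length (filter (R? x) ys) ≡ sum (map (λ y → [ R? x y ]) ys)
    length-filter-as-sum x []       = refl
    length-filter-as-sum x (y ∷ ys) with R? x y
    ... | yes _ = cong suc (length-filter-as-sum x ys)
    ... | no  _ = length-filter-as-sum x ys

    sum-map-+ : ∀ (f g : B → ℕ) ys → sum (map (λ y → f y + g y) ys) ≡ sum (map f ys) + sum (map g ys)
    sum-map-+ f g []       = refl
    sum-map-+ f g (y ∷ ys) = trans (cong (f y + g y +_) (sum-map-+ f g ys)) (+-interchange (f y) (g y) _ _)

  double-counting : ∀ xs ys →
    sum (map (λ x → length (filter (R? x) ys)) xs) ≡
    sum (map (λ y → length (filter (flip R? y) xs)) ys)
  double-counting [] ys = sym (trans (sum-map-const ys (λ _ → refl)) (*-zeroʳ (length ys)))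
  double-counting (x ∷ xs) ys = begin
      length (filter (R? x) ys) + sum (map (λ x → length (filter (R? x) ys)) xs)
    ≡⟨ cong₂ _+_ (length-filter-as-sum x ys) (double-counting xs ys) ⟩
      sum (map (λ y → [ R? x y ]) ys) + sum (map (λ y → length (filter (flip R? y) xs)) ys)
    ≡⟨ sum-map-+ _ _ ys ⟨
      sum (map (λ y → [ R? x y ] + length (filter (flip R? y) xs)) ys)
    ≡⟨ cong sum (map-cong (λ y → sym (length-filter-∷ (flip R? y) x xs)) ys) ⟩
      sum (map (λ y → length (filter (flip R? y) (x ∷ xs))) ys) ∎
    where open ≡-Reasoning

length-cartesianProductWith : ∀ {A B C : Set} (f : A → B → C) xs ys →
  length (cartesianProductWith f xs ys) ≡ length xs * length ys
length-cartesianProductWith f []       ys = refl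
length-cartesianProductWith f (x ∷ xs) ys =
  trans (length-++ (map (f x) ys)) (cong₂ _+_ (length-map (f x) ys) (length-cartesianProductWith f xs ys))

concatMap-map≡cartesianProductWith : ∀ {A B C : Set} (f : A → B → C) xs ys →
  concatMap (λ x → map (f x) ys) xs ≡ cartesianProductWith f xs ys
concatMap-map≡cartesianProductWith f []       ys = refl
concatMap-map≡cartesianProductWith f (x ∷ xs) ys =
  cong (map (f x) ys ++_) (concatMap-map≡cartesianProductWith f xs ys)

module _ {A : Set} (xs : List A) where

  vecsOver-suc : ∀ n → vecsOver xs (suc n) ≡ cartesianProductWith _∷_ xs (vecsOver xs n)
  vecsOver-suc n = concatMap-map≡cartesianProductWith _∷_ xs (vecsOver xs n)

  length-vecsOver : ∀ n → length (vecsOver xs n) ≡ length xs ^ n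
  length-vecsOver zero    = refl
  length-vecsOver (suc n) = begin
    length (vecsOver xs (suc n))                             ≡⟨ cong length (vecsOver-suc n) ⟩
    length (cartesianProductWith _∷_ xs (vecsOver xs n))     ≡⟨ length-cartesianProductWith _∷_ xs _ ⟩
    length xs * length (vecsOver xs n)                       ≡⟨ cong (length xs *_) (length-vecsOver n) ⟩
    length xs * length xs ^ n                                ∎
    where open ≡-Reasoning

  ∈-vecsOver : (∀ a → a ∈ xs) → ∀ {n} (v : Vec A n) → v ∈ vecsOver xs n
  ∈-vecsOver all∈ []      = here refl
  ∈-vecsOver all∈ (a ∷ v) =
    subst (_ ∈_) (sym (vecsOver-suc _)) (∈-cartesianProductWith⁺ _∷_ (all∈ a) (∈-vecsOver all∈ v))

  vecsOver-unique : Unique xs → ∀ n → Unique (vecsOver xs n)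
  vecsOver-unique u zero    = All.[] ∷ []
  vecsOver-unique u (suc n) = subst Unique (sym (vecsOver-suc n))
    (Unique.cartesianProductWith⁺ _∷_ ∷-injective u (vecsOver-unique u n))

module _ {A : Set} where

  ∈-subsets⇒⊆ : ∀ xs {S} → S ∈ subsets xs → ∀ {e : A} → e ∈ S → e ∈ xs
  ∈-subsets⇒⊆ []       (here refl) ()
  ∈-subsets⇒⊆ (x ∷ xs) S∈ e∈ with ∈-++⁻ (subsets xs) S∈
  ... | inj₁ S∈′ = there (∈-subsets⇒⊆ xs S∈′ e∈)
  ... | inj₂ S∈′ with ∈-map⁻ (x ∷_) S∈′ | e∈
  ... | _ , _   , refl | here refl = here refl
  ... | _ , T∈ , refl | there e∈′ = there (∈-subsets⇒⊆ xs T∈ e∈′)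

  filter∈subsets : ∀ {P : A → Set} (P? : Decidable P) xs → filter P? xs ∈ subsets xs
  filter∈subsets P? []       = here refl
  filter∈subsets P? (x ∷ xs) with P? x
  ... | yes _ = ∈-++⁺ʳ (subsets xs) (∈-map⁺ (x ∷_) (filter∈subsets P? xs))
  ... | no  _ = ∈-++⁺ˡ (filter∈subsets P? xs)

  private
    x∉subsets : ∀ {x : A} {xs} → All.All (x ≢_) xs → ∀ {S} → S ∈ subsets xs → ∀ {e} → e ∈ S → e ≢ x
    x∉subsets x∉xs S∈ e∈ refl = All.lookup x∉xs (∈-subsets⇒⊆ _ S∈ e∈) refl

  subsets-unique : ∀ {xs : List A} → Unique xs → Unique (subsets xs)
  subsets-unique {[]}     _           = All.[] ∷ []
  subsets-unique {x ∷ xs} (x∉xs ∷ u) =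
    Unique.++⁺ (subsets-unique u) (Unique.map⁺ (λ { refl → refl }) (subsets-unique u)) disjoint
    where
    disjoint : ∀ {S} → S ∈ subsets xs × S ∈ map (x ∷_) (subsets xs) → ⊥
    disjoint (S∈ , S∈′) with ∈-map⁻ (x ∷_) S∈′
    ... | _ , _ , refl = x∉subsets x∉xs S∈ (here refl) refl

  subsets-extensional : ∀ {xs : List A} → Unique xs → ∀ {S T} → S ∈ subsets xs → T ∈ subsets xs →
                        (∀ {e} → e ∈ S → e ∈ T) → (∀ {e} → e ∈ T → e ∈ S) → S ≡ T
  subsets-extensional {[]} _ (here refl) (here refl) _ _ = refl
  subsets-extensional {x ∷ xs} (x∉xs ∷ u) S∈ T∈ S⊆T T⊆S
    with ∈-++⁻ (subsets xs) S∈ | ∈-++⁻ (subsets xs) T∈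
  ... | inj₁ S∈′ | inj₁ T∈′ = subsets-extensional u S∈′ T∈′ S⊆T T⊆S
  ... | inj₁ S∈′ | inj₂ T∈′ with ∈-map⁻ (x ∷_) T∈′
  ...   | _ , _ , refl = ⊥-elim (x∉subsets x∉xs S∈′ (T⊆S (here refl)) refl)
  subsets-extensional {x ∷ xs} (x∉xs ∷ u) S∈ T∈ S⊆T T⊆S | inj₂ S∈′ | inj₁ T∈′ with ∈-map⁻ (x ∷_) S∈′
  ...   | _ , _ , refl = ⊥-elim (x∉subsets x∉xs T∈′ (S⊆T (here refl)) refl)
  subsets-extensional {x ∷ xs} (x∉xs ∷ u) S∈ T∈ S⊆T T⊆S | inj₂ S∈′ | inj₂ T∈′
    with ∈-map⁻ (x ∷_) S∈′ | ∈-map⁻ (x ∷_) T∈′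
  ... | S , S∈″ , refl | T , T∈″ , refl = cong (x ∷_) (subsets-extensional u S∈″ T∈″ (drop-x S∈″ S⊆T) (drop-x T∈″ T⊆S))
    where
    drop-x : ∀ {U V} → U ∈ subsets xs → (∀ {e} → e ∈ x ∷ U → e ∈ x ∷ V) → ∀ {e} → e ∈ U → e ∈ V
    drop-x U∈ U⊆V e∈ with U⊆V (there e∈)
    ... | here refl = ⊥-elim (x∉subsets x∉xs U∈ e∈ refl)
    ... | there e∈′ = e∈′

module _ {ℓ : ℕ} where

  occ-here : ∀ (x : Fin ℓ) L → occ x (x ∷ L) ≡ suc (occ x L)
  occ-here x L with x ≟ x
  ... | yes _   = refl
  ... | no  x≢x = ⊥-elim (x≢x refl)

  occ-there : ∀ {a x : Fin ℓ} L → a ≢ x → occ a (x ∷ L) ≡ occ a L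
  occ-there {a} {x} L a≢x with x ≟ a
  ... | yes x≡a = ⊥-elim (a≢x (sym x≡a))
  ... | no  _   = refl

  ∈⇒occ-pos : ∀ {a : Fin ℓ} {L} → a ∈ L → 1 ≤ occ a L
  ∈⇒occ-pos {a} {x ∷ L} a∈ with x ≟ a | a∈
  ... | yes _   | _          = s≤s z≤n
  ... | no  x≢a | here refl  = ⊥-elim (x≢a refl)
  ... | no  _   | there a∈′ = ∈⇒occ-pos a∈′

  occ-pos⇒∈ : ∀ {a : Fin ℓ} L → 1 ≤ occ a L → a ∈ L
  occ-pos⇒∈ {a} (x ∷ L) pos with x ≟ a
  ... | yes refl = here refl
  ... | no  _    = there (occ-pos⇒∈ L pos)

  occ-∷ : ∀ (a x : Fin ℓ) L → occ a (x ∷ L) ≡ occ a (x ∷ []) + occ a L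
  occ-∷ a x L with x ≟ a
  ... | yes _ = refl
  ... | no  _ = refl

∑-zero : ∀ {k} {f : Fin k → ℕ} → (∀ a → f a ≡ 0) → ∑ f ≡ 0
∑-zero {k} f≡0 = trans (∑-cong-≗ f≡0) (∑-replicate-0 k)

∑-even : ∀ {k} (f : Fin k → ℕ) → (∀ a → 2 ∣ f a) → 2 ∣ ∑ f
∑-even {zero}  f even = 2 ∣0
∑-even {suc k} f even = ∣m∣n⇒∣m+n (even zero) (∑-even (f ∘ suc) (even ∘ suc))

∑-≥ : ∀ {k} (f : Fin k → ℕ) {c} → (∀ a → c ≤ f a) → k * c ≤ ∑ f
∑-≥ {zero}  f c≤f = z≤n
∑-≥ {suc k} f c≤f = +-mono-≤ (c≤f zero) (∑-≥ (f ∘ suc) (c≤f ∘ suc))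

∑-tight : ∀ {k} (f : Fin k → ℕ) {c} → (∀ a → c ≤ f a) → ∑ f ≡ k * c → ∀ a → f a ≡ c
∑-tight {suc k} f {c} c≤f eq = λ
  { zero    → proj₁ split
  ; (suc a) → ∑-tight (f ∘ suc) (c≤f ∘ suc) (proj₂ split) a }
  where
  split : f zero ≡ c × ∑ (f ∘ suc) ≡ k * c
  split = +-tight (c≤f zero) (∑-≥ (f ∘ suc) (c≤f ∘ suc)) eq
    where
    +-tight : ∀ {a b c d} → c ≤ a → d ≤ b → a + b ≡ c + d → a ≡ c × b ≡ d
    +-tight {a} {b} {c} {d} c≤a d≤b a+b≡c+d =
        ≤-antisym (+-cancelʳ-≤ b a c (≤-trans (≤-reflexive a+b≡c+d) (+-monoʳ-≤ c d≤b))) c≤a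
      , ≤-antisym (+-cancelˡ-≤ a b d (≤-trans (≤-reflexive a+b≡c+d) (+-monoˡ-≤ d c≤a))) d≤b

∑-occ-singleton : ∀ {ℓ} (x : Fin ℓ) → ∑ (λ a → occ a (x ∷ [])) ≡ 1
∑-occ-singleton {suc ℓ} zero    = cong suc (∑-zero {ℓ} λ a → occ-there {a = suc a} {x = zero} [] λ ())
∑-occ-singleton {suc ℓ} (suc x) = trans (∑-cong-≗ occ-suc) (∑-occ-singleton x)
  where
  occ-suc : ∀ a → occ (suc a) (suc x ∷ []) ≡ occ a (x ∷ [])
  occ-suc a with x ≟ a | suc x ≟ suc a
  ... | yes _   | yes _ = refl
  ... | no  _   | no  _ = refl
  ... | yes x≡a | no  s≢s = ⊥-elim (s≢s (cong suc x≡a))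
  ... | no  x≢a | yes s≡s = ⊥-elim (x≢a (suc-injective s≡s))

∑-occ : ∀ {ℓ} (L : List (Fin ℓ)) → ∑ (λ a → occ a L) ≡ length L
∑-occ {ℓ} []  = ∑-zero {ℓ} {λ a → occ a []} λ _ → refl
∑-occ (x ∷ L) = begin
  ∑ (λ a → occ a (x ∷ L))                      ≡⟨ ∑-cong-≗ (λ a → occ-∷ a x L) ⟩
  ∑ (λ a → occ a (x ∷ []) + occ a L)           ≡⟨ ∑-distrib-+ (λ a → occ a (x ∷ [])) (λ a → occ a L) ⟩
  ∑ (λ a → occ a (x ∷ [])) + ∑ (λ a → occ a L) ≡⟨ cong₂ _+_ (∑-occ-singleton x) (∑-occ L) ⟩
  suc (length L)                               ∎
  where open ≡-Reasoning

AllEven⇒even-length : ∀ {ℓ} (L : List (Fin ℓ)) → AllEven L → 2 ∣ length L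
AllEven⇒even-length L even = subst (2 ∣_) (∑-occ L) (∑-even _ even)

length-filter-map : ∀ {A B : Set} {P : B → Set} (P? : Decidable P) (g : A → B) xs →
                    length (filter P? (map g xs)) ≡ length (filter (P? ∘ g) xs)
length-filter-map P? g []       = refl
length-filter-map P? g (x ∷ xs) with P? (g x)
... | yes _ = cong suc (length-filter-map P? g xs)
... | no  _ = length-filter-map P? g xs

length-filter-vecsOver-suc : ∀ {A : Set} {P : ∀ {k} → Vec A k → Set} (P? : ∀ {k} → Decidable (P {k}))
  xs k → length (filter P? (vecsOver xs (suc k))) ≡
         sum (map (λ x → length (filter (P? ∘ (x ∷_)) (vecsOver xs k))) xs)
length-filter-vecsOver-suc P? xs k = go xs
  where
  go : ∀ ys → length (filter P? (concatMap (λ x → map (x ∷_) (vecsOver xs k)) ys)) ≡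
              sum (map (λ x → length (filter (P? ∘ (x ∷_)) (vecsOver xs k))) ys)
  go []       = refl
  go (y ∷ ys) = begin
    length (filter P? (map (y ∷_) V ++ concatMap (λ x → map (x ∷_) V) ys))
      ≡⟨ cong length (filter-++ P? (map (y ∷_) V) _) ⟩
    length (filter P? (map (y ∷_) V) ++ filter P? (concatMap (λ x → map (x ∷_) V) ys))
      ≡⟨ length-++ (filter P? (map (y ∷_) V)) ⟩
    length (filter P? (map (y ∷_) V)) + length (filter P? (concatMap (λ x → map (x ∷_) V) ys))
      ≡⟨ cong₂ _+_ (length-filter-map P? (y ∷_) V) (go ys) ⟩
    _ ∎
    where
    open ≡-Reasoning
    V = vecsOver xs k

∑-allFin : ∀ {ℓ} (g : Fin ℓ → ℕ) → sum (map g (allFin ℓ)) ≡ ∑ g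
∑-allFin g = trans (cong sum (map-tabulate (λ i → i) g)) (sum-tabulate g)
  where
  sum-tabulate : ∀ {k} (f : Fin k → ℕ) → sum (List.tabulate f) ≡ ∑ f
  sum-tabulate {zero}  f = refl
  sum-tabulate {suc k} f = cong (f zero +_) (sum-tabulate (f ∘ suc))

∑-mono-≤ : ∀ {k} {f g : Fin k → ℕ} → (∀ a → f a ≤ g a) → ∑ f ≤ ∑ g
∑-mono-≤ {zero}  f≤g = z≤n
∑-mono-≤ {suc k} f≤g = +-mono-≤ (f≤g zero) (∑-mono-≤ (f≤g ∘ suc))

decrement : ∀ {ℓ} → (Fin ℓ → ℕ) → Fin ℓ → Fin ℓ → ℕ
decrement c x = updateAt c x pred

removeAt-decrement : ∀ {ℓ} (c : Fin (suc ℓ) → ℕ) x → removeAt (decrement c x) x ≗ removeAt c x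
removeAt-decrement c x j = updateAt-minimal (punchIn x j) x c (punchInᵢ≢i x j)

∑-decrement : ∀ {ℓ} (c : Fin ℓ → ℕ) x → 1 ≤ c x → suc (∑ (decrement c x)) ≡ ∑ c
∑-decrement {suc ℓ} c x 1≤cx = begin
  suc (∑ (decrement c x))                                ≡⟨ cong suc (∑-remove (decrement c x)) ⟩
  suc (decrement c x x + ∑ (removeAt (decrement c x) x)) ≡⟨ cong₂ (λ a b → suc (a + b)) (updateAt-updates x c) (∑-cong-≗ (removeAt-decrement c x)) ⟩
  suc (pred (c x)) + ∑ (removeAt c x)                    ≡⟨ cong (_+ ∑ (removeAt c x)) (suc-pred (c x) {{>-nonZero 1≤cx}}) ⟩
  c x + ∑ (removeAt c x)                                 ≡⟨ ∑-remove c ⟨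
  ∑ c                                                    ∎
  where open ≡-Reasoning

∏-decrement : ∀ {ℓ} (c : Fin ℓ → ℕ) x → 1 ≤ c x →
              c x * ∏ (λ a → decrement c x a !) ≡ ∏ (λ a → c a !)
∏-decrement {suc ℓ} c x 1≤cx with c x in cx≡
... | suc m = begin
  suc m * ∏ (λ a → decrement c x a !)
    ≡⟨ cong (suc m *_) (∏-remove (λ a → decrement c x a !)) ⟩
  suc m * (decrement c x x ! * ∏ (removeAt (λ a → decrement c x a !) x))
    ≡⟨ cong₂ (λ d r → suc m * (d ! * r)) (trans (updateAt-updates x c) (cong pred cx≡)) (∏-cong-≗ (cong _! ∘ removeAt-decrement c x)) ⟩
  suc m * (m ! * ∏ (removeAt (λ a → c a !) x))
    ≡⟨ *-assoc (suc m) (m !) (∏ (removeAt (λ a → c a !) x)) ⟨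
  suc m ! * ∏ (removeAt (λ a → c a !) x)
    ≡⟨ cong (λ n → n ! * ∏ (removeAt (λ a → c a !) x)) cx≡ ⟨
  c x ! * ∏ (removeAt (λ a → c a !) x)
    ≡⟨ ∏-remove (λ a → c a !) ⟨
  ∏ (λ a → c a !) ∎
  where open ≡-Reasoning

module _ {ℓ : ℕ} where

  HasCounts : (Fin ℓ → ℕ) → ∀ {k} → Vec (Fin ℓ) k → Set
  HasCounts c w = ∀ a → occ a (toList w) ≡ c a

  hasCounts? : ∀ c {k} → Decidable (HasCounts c {k})
  hasCounts? c w = all? (λ a → occ a (toList w) ℕ.≟ c a)

  wordsWithCounts : ℕ → (Fin ℓ → ℕ) → ℕ
  wordsWithCounts k c = length (filter (hasCounts? c) (vecsOver (allFin ℓ) k))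

  module _ {c : Fin ℓ → ℕ} {x : Fin ℓ} {k} {w : Vec (Fin ℓ) k} where

    HasCounts-∷⁻ : HasCounts c (x ∷ w) → 1 ≤ c x × HasCounts (decrement c x) w
    HasCounts-∷⁻ counts = subst (1 ≤_) (trans (sym (occ-here x (toList w))) (counts x)) (s≤s z≤n) , counts′
      where
      counts′ : HasCounts (decrement c x) w
      counts′ a with a ≟ x
      ... | yes refl = trans (cong pred (trans (sym (occ-here a (toList w))) (counts a))) (sym (updateAt-updates a c))
      ... | no  a≢x  = trans (trans (sym (occ-there (toList w) a≢x)) (counts a)) (sym (updateAt-minimal a x c a≢x))

    HasCounts-∷⁺ : 1 ≤ c x → HasCounts (decrement c x) w → HasCounts c (x ∷ w)
    HasCounts-∷⁺ 1≤cx counts a with a ≟ x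
    ... | yes refl = trans (occ-here a (toList w))
                       (trans (cong suc (trans (counts a) (updateAt-updates a c))) (suc-pred (c a) {{>-nonZero 1≤cx}}))
    ... | no  a≢x  = trans (occ-there (toList w) a≢x) (trans (counts a) (updateAt-minimal a x c a≢x))

  wordsStartingWith : ℕ → (Fin ℓ → ℕ) → Fin ℓ → ℕ
  wordsStartingWith k c x = length (filter (hasCounts? c ∘ (x ∷_)) (vecsOver (allFin ℓ) k))

  wordsWithCounts-suc : ∀ k c → wordsWithCounts (suc k) c ≡ ∑ (wordsStartingWith k c)
  wordsWithCounts-suc k c =
    trans (length-filter-vecsOver-suc (hasCounts? c) (allFin ℓ) k) (∑-allFin (wordsStartingWith k c))

  wordsStartingWith-absent : ∀ k c x → c x ≡ 0 → wordsStartingWith k c x ≡ 0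
  wordsStartingWith-absent k c x cx≡0 = cong length (filter-none (hasCounts? c ∘ (x ∷_))
    (universal (λ w counts → 1≰0 (subst (1 ≤_) cx≡0 (proj₁ (HasCounts-∷⁻ counts)))) (vecsOver (allFin ℓ) k)))
    where
    1≰0 : ¬ 1 ≤ 0
    1≰0 ()

  wordsStartingWith-present : ∀ k c x → 1 ≤ c x → wordsStartingWith k c x ≡ wordsWithCounts k (decrement c x)
  wordsStartingWith-present k c x 1≤cx = cong length (filter-≐ (hasCounts? c ∘ (x ∷_)) (hasCounts? (decrement c x))
    ((proj₂ ∘ HasCounts-∷⁻) , HasCounts-∷⁺ 1≤cx) (vecsOver (allFin ℓ) k))

  wordsWithCounts-bound : ∀ k (c : Fin ℓ → ℕ) → ∑ c ≡ k → wordsWithCounts k c * ∏ (λ a → c a !) ≤ k !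
  wordsWithCounts-bound zero c _ with hasCounts? c []
  ... | yes counts = ≤-reflexive (begin
    length (filter (hasCounts? c) ([] ∷ [])) * ∏ (λ a → c a !)
      ≡⟨ cong (λ ws → length ws * ∏ (λ a → c a !)) (filter-accept (hasCounts? c) counts) ⟩
    1 * ∏ (λ a → c a !)
      ≡⟨ +-identityʳ _ ⟩
    ∏ (λ a → c a !)
      ≡⟨ ∏-cong-≗ (λ a → cong _! (sym (counts a))) ⟩
    ∏ {ℓ} (λ _ → 1)
      ≡⟨ ∏-replicate-1 ℓ ⟩
    1 ∎)
    where open ≡-Reasoning
  ... | no ¬counts = subst (_≤ 1) (sym (cong (λ ws → length ws * ∏ (λ a → c a !)) (filter-reject (hasCounts? c) ¬counts))) z≤n
  wordsWithCounts-bound (suc k) c ∑c≡k = begin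
    wordsWithCounts (suc k) c * P         ≡⟨ cong (_* P) (wordsWithCounts-suc k c) ⟩
    ∑ (wordsStartingWith k c) * P         ≡⟨ *-distribʳ-∑ P (wordsStartingWith k c) ⟩
    ∑ (λ x → wordsStartingWith k c x * P) ≤⟨ ∑-mono-≤ starting-bound ⟩
    ∑ (λ x → c x * k !)                   ≡⟨ *-distribʳ-∑ (k !) c ⟨
    ∑ c * k !                             ≡⟨ cong (_* k !) ∑c≡k ⟩
    suc k !                               ∎
    where
    open ≤-Reasoning
    P = ∏ (λ a → c a !)
    starting-bound : ∀ x → wordsStartingWith k c x * P ≤ c x * k !
    starting-bound x with c x ℕ.≟ 0
    ... | yes cx≡0 = subst (λ n → n * P ≤ c x * k !) (sym (wordsStartingWith-absent k c x cx≡0)) z≤n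
    ... | no  cx≢0 = begin
      wordsStartingWith k c x * P                    ≡⟨ cong₂ _*_ (wordsStartingWith-present k c x 1≤cx) (sym (∏-decrement c x 1≤cx)) ⟩
      W⁻ * (c x * P⁻)                                ≡⟨ x*[y*z]≡y*[x*z] W⁻ (c x) P⁻ ⟩
      c x * (W⁻ * P⁻)                                ≤⟨ *-monoʳ-≤ (c x) (wordsWithCounts-bound k (decrement c x) ∑c⁻≡k) ⟩
      c x * k !                                      ∎
      where
      1≤cx = n≢0⇒n>0 cx≢0
      ∑c⁻≡k = cong pred (trans (∑-decrement c x 1≤cx) ∑c≡k)
      W⁻ = wordsWithCounts k (decrement c x)
      P⁻ = ∏ (λ a → decrement c x a !)
      x*[y*z]≡y*[x*z] : ∀ x y z → x * (y * z) ≡ y * (x * z)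
      x*[y*z]≡y*[x*z] x y z = trans (sym (*-assoc x y z)) (trans (cong (_* z) (*-comm x y)) (*-assoc y x z))

module _ {ℓ : ℕ} where

  flips : List (Fin ℓ) → Vtx ℓ → Vtx ℓ
  flips []      v = v
  flips (i ∷ L) v = flips L (flipAt i v)

  flips-++ : ∀ L M (v : Vtx ℓ) → flips (L ++ M) v ≡ flips M (flips L v)
  flips-++ []      M v = refl
  flips-++ (i ∷ L) M v = flips-++ L M (flipAt i v)

  lookup-flipAt : ∀ i (v : Vtx ℓ) → lookup (flipAt i v) i ≡ not (lookup v i)
  lookup-flipAt i v = lookup∘updateAt i v

  lookup-flipAt′ : ∀ {i j} (v : Vtx ℓ) → j ≢ i → lookup (flipAt i v) j ≡ lookup v j
  lookup-flipAt′ {i} {j} v j≢i = lookup∘updateAt′ j i j≢i v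

  flipAt-involutive : ∀ i (v : Vtx ℓ) → flipAt i (flipAt i v) ≡ v
  flipAt-involutive i v =
    trans (updateAt-updateAt i v) (updateAt-id-local i v (not-involutive (lookup v i)))

  flipAt-injectiveˡ : ∀ {i j} (v : Vtx ℓ) → flipAt i v ≡ flipAt j v → i ≡ j
  flipAt-injectiveˡ {i} {j} v eq with i ≟ j
  ... | yes i≡j = i≡j
  ... | no  i≢j = ⊥-elim (not-¬ refl (sym (begin
    not (lookup v i)      ≡⟨ lookup-flipAt i v ⟨
    lookup (flipAt i v) i ≡⟨ cong (λ w → lookup w i) eq ⟩
    lookup (flipAt j v) i ≡⟨ lookup-flipAt′ v i≢j ⟩
    lookup v i            ∎)))
    where open ≡-Reasoning

  lookup-flips : ∀ L (v : Vtx ℓ) j → lookup (flips L v) j ≡ iterate not (lookup v j) (occ j L)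
  lookup-flips []      v j = refl
  lookup-flips (i ∷ L) v j with i ≟ j
  ... | yes refl = trans (lookup-flips L (flipAt i v) i) (cong (λ b → iterate not b (occ i L)) (lookup-flipAt i v))
  ... | no  i≢j  = trans (lookup-flips L (flipAt i v) j) (cong (λ b → iterate not b (occ j L)) (lookup-flipAt′ v (i≢j ∘ sym)))

iterate-not-even : ∀ b {n} → 2 ∣ n → iterate not b n ≡ b
iterate-not-even b (divides q refl) = go q
  where
  go : ∀ q → iterate not b (q * 2) ≡ b
  go zero    = refl
  go (suc q) = trans (cong (λ c → iterate not c (q * 2)) (not-involutive b)) (go q)

iterate-not-fixed⇒even : ∀ b n → iterate not b n ≡ b → 2 ∣ n
iterate-not-fixed⇒even b zero          _  = 2 ∣0
iterate-not-fixed⇒even b (suc zero)    eq = ⊥-elim (not-¬ refl (sym eq))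
iterate-not-fixed⇒even b (suc (suc n)) eq = ∣m∣n⇒∣m+n ∣-refl
  (iterate-not-fixed⇒even b n (subst (λ c → iterate not c n ≡ b) (not-involutive b) eq))

module _ {ℓ : ℕ} where

  flips-fixed⇒AllEven : ∀ L (v : Vtx ℓ) → flips L v ≡ v → AllEven L
  flips-fixed⇒AllEven L v eq j = iterate-not-fixed⇒even (lookup v j) (occ j L)
    (trans (sym (lookup-flips L v j)) (cong (λ w → lookup w j) eq))

  AllEven⇒flips-fixed : ∀ L (v : Vtx ℓ) → AllEven L → flips L v ≡ v
  AllEven⇒flips-fixed L v even = begin
    flips L v                            ≡⟨ tabulate∘lookup (flips L v) ⟨
    tabulate (lookup (flips L v))        ≡⟨ tabulate-cong (λ j → trans (lookup-flips L v j) (iterate-not-even _ (even j))) ⟩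
    tabulate (lookup v)                  ≡⟨ tabulate∘lookup v ⟩
    v                                    ∎
    where open ≡-Reasoning

flipCoord : ∀ {k} → Vec Bool k → Vec Bool k → Maybe (Fin k)
flipCoord []      []      = nothing
flipCoord (x ∷ a) (y ∷ b) = if does (x Bool.≟ y) then Maybe.map suc (flipCoord a b) else just zero

flipCoord-flipAt : ∀ {k} i (a : Vtx k) → flipCoord a (flipAt i a) ≡ just i
flipCoord-flipAt zero    (true  ∷ a) = refl
flipCoord-flipAt zero    (false ∷ a) = refl
flipCoord-flipAt (suc i) (true  ∷ a) = cong (Maybe.map suc) (flipCoord-flipAt i a)
flipCoord-flipAt (suc i) (false ∷ a) = cong (Maybe.map suc) (flipCoord-flipAt i a)

module _ {ℓ : ℕ} where

  private
    bits : List Bool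
    bits = true ∷ false ∷ []

    ∈-bits : ∀ b → b ∈ bits
    ∈-bits true  = here refl
    ∈-bits false = there (here refl)

    isLowerEnd? : Decidable (λ (e : Edge ℓ) → lookup (proj₁ e) (proj₂ e) ≡ false)
    isLowerEnd? (v , i) = lookup v i Bool.≟ false

  ∈-allVtx : ∀ (v : Vtx ℓ) → v ∈ allVtx ℓ
  ∈-allVtx = ∈-vecsOver bits ∈-bits

  allVtx-unique : Unique (allVtx ℓ)
  allVtx-unique = vecsOver-unique bits (((λ ()) All.∷ All.[]) ∷ All.[] ∷ []) ℓ

  ∈-edgesQ⁺ : ∀ {v : Vtx ℓ} {i} → lookup v i ≡ false → (v , i) ∈ edgesQ ℓ
  ∈-edgesQ⁺ {v} {i} vᵢ≡0 = ∈-filter⁺ isLowerEnd? (∈-cartesianProduct⁺ (∈-allVtx v) (∈-allFin i)) vᵢ≡0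

  ∈-edgesQ⁻ : ∀ {v : Vtx ℓ} {i} → (v , i) ∈ edgesQ ℓ → lookup v i ≡ false
  ∈-edgesQ⁻ e∈ = proj₂ (∈-filter⁻ isLowerEnd? {xs = cartesianProduct (allVtx ℓ) (allFin ℓ)} e∈)

  edgesQ-unique : Unique (edgesQ ℓ)
  edgesQ-unique = Unique.filter⁺ isLowerEnd? (Unique.cartesianProduct⁺ allVtx-unique (Unique.allFin⁺ ℓ))

  Joins⇒flipAt : ∀ {v i} {a b : Vtx ℓ} → Joins (v , i) a b → b ≡ flipAt i a
  Joins⇒flipAt         (inj₁ (refl , refl)) = refl
  Joins⇒flipAt {v} {i} (inj₂ (refl , refl)) = sym (flipAt-involutive i v)

  Joins-sym : ∀ {e : Edge ℓ} {a b} → Joins e a b → Joins e b a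
  Joins-sym (inj₁ J) = inj₂ J
  Joins-sym (inj₂ J) = inj₁ J

  Joins-endpoints : ∀ {e : Edge ℓ} {a b c d} → Joins e a b → Joins e c d → (a ≡ c × b ≡ d) ⊎ (a ≡ d × b ≡ c)
  Joins-endpoints (inj₁ (refl , refl)) (inj₁ (refl , refl)) = inj₁ (refl , refl)
  Joins-endpoints (inj₁ (refl , refl)) (inj₂ (refl , refl)) = inj₂ (refl , refl)
  Joins-endpoints (inj₂ (refl , refl)) (inj₁ (refl , refl)) = inj₂ (refl , refl)
  Joins-endpoints (inj₂ (refl , refl)) (inj₂ (refl , refl)) = inj₁ (refl , refl)

  private
    Joins⇒lower-end : ∀ {v i} {a b : Vtx ℓ} → Joins (v , i) a b → v ≡ a ⊎ v ≡ flipAt i a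
    Joins⇒lower-end         (inj₁ (refl , _))   = inj₁ refl
    Joins⇒lower-end {v} {i} (inj₂ (_ , refl))   = inj₂ (sym (flipAt-involutive i v))

    both-ends-lower : ∀ {i} {a : Vtx ℓ} → lookup a i ≡ false → lookup (flipAt i a) i ≡ false → ⊥
    both-ends-lower {i} {a} a₀ fa₀ with () ← trans (sym (cong not a₀)) (trans (sym (lookup-flipAt i a)) fa₀)

    lower-end-unique : ∀ {i} {a v v′ : Vtx ℓ} → lookup v i ≡ false → lookup v′ i ≡ false →
                       v ≡ a ⊎ v ≡ flipAt i a → v′ ≡ a ⊎ v′ ≡ flipAt i a → v ≡ v′
    lower-end-unique             _  _  (inj₁ refl) (inj₁ refl) = refl
    lower-end-unique             _  _  (inj₂ refl) (inj₂ refl) = refl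
    lower-end-unique {i} {a} a₀ fa₀ (inj₁ refl) (inj₂ refl) = ⊥-elim (both-ends-lower {i} {a} a₀ fa₀)
    lower-end-unique {i} {a} fa₀ a₀ (inj₂ refl) (inj₁ refl) = ⊥-elim (both-ends-lower {i} {a} a₀ fa₀)

  Joins-injective : ∀ {v v′ : Vtx ℓ} {i i′ a b} → lookup v i ≡ false → lookup v′ i′ ≡ false →
                    Joins (v , i) a b → Joins (v′ , i′) a b → (v , i) ≡ (v′ , i′)
  Joins-injective {a = a} v₀ v′₀ J J′ with flipAt-injectiveˡ a (trans (sym (Joins⇒flipAt J)) (Joins⇒flipAt J′))
  ... | refl = cong (_, _) (lower-end-unique v₀ v′₀ (Joins⇒lower-end J) (Joins⇒lower-end J′))

  edgeAt : Vtx ℓ → Fin ℓ → Edge ℓ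
  edgeAt a i with lookup a i
  ... | false = a , i
  ... | true  = flipAt i a , i

  edgeAt-spec : ∀ a i → Joins (edgeAt a i) a (flipAt i a) × edgeAt a i ∈ edgesQ ℓ × proj₂ (edgeAt a i) ≡ i
  edgeAt-spec a i with lookup a i in aᵢ
  ... | false = inj₁ (refl , refl) , ∈-edgesQ⁺ aᵢ , refl
  ... | true  = inj₂ (refl , sym (flipAt-involutive i a)) , ∈-edgesQ⁺ (trans (lookup-flipAt i a) (cong not aᵢ)) , refl

isTarget? : ∀ {ℓ} (S : List (Edge ℓ)) → Dec (IsCycle (2 * ℓ) S × UsesAllCoords S)
isTarget? {ℓ} S = isCycle? (2 * ℓ) S ×-dec usesAllCoords? S

cycles : ∀ ℓ → List (List (Edge ℓ))
cycles ℓ = filter isTarget? (subsets (edgesQ ℓ))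

zℓℓ≡length-cycles : ∀ ℓ → zℓℓ ℓ ≡ length (cycles ℓ)
zℓℓ≡length-cycles ℓ = refl

pairs : ∀ ℓ → List (Vtx ℓ × Word ℓ)
pairs ℓ = cartesianProduct (allVtx ℓ) (filter inZ? (vecsOver (allFin ℓ) (2 * ℓ)))

module _ {ℓ : ℕ} where

  ∈-pairs⁺ : ∀ {v : Vtx ℓ} {word} → InZ word → (v , word) ∈ pairs ℓ
  ∈-pairs⁺ {v} {word} inZ = ∈-cartesianProduct⁺ (∈-allVtx v) (∈-filter⁺ inZ? (∈-vecsOver (allFin ℓ) ∈-allFin word) inZ)

  ∈-pairs⁻ : ∀ {v : Vtx ℓ} {word} → (v , word) ∈ pairs ℓ → InZ word
  ∈-pairs⁻ y∈ = proj₂ (∈-filter⁻ inZ? {xs = vecsOver (allFin ℓ) (2 * ℓ)} (proj₂ (∈-cartesianProduct⁻ (allVtx ℓ) _ y∈)))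

  pairs-unique : Unique (pairs ℓ)
  pairs-unique = Unique.cartesianProduct⁺ allVtx-unique (Unique.filter⁺ inZ? (vecsOver-unique (allFin ℓ) (Unique.allFin⁺ ℓ) (2 * ℓ)))

length-pairs : ∀ ℓ → length (pairs ℓ) ≡ 2 ^ ℓ * cardZ ℓ
length-pairs ℓ = trans (length-cartesianProductWith _,_ (allVtx ℓ) _) (cong (_* cardZ ℓ) (length-vecsOver (true ∷ false ∷ []) ℓ))

module _ {A : Set} where

  applyUpTo-+ : ∀ (f : ℕ → A) s k → applyUpTo f (s + k) ≡ applyUpTo f s ++ applyUpTo (f ∘ (s +_)) k
  applyUpTo-+ f zero    k = refl
  applyUpTo-+ f (suc s) k = cong (f 0 ∷_) (applyUpTo-+ (f ∘ suc) s k)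

  take-applyUpTo : ∀ (f : ℕ → A) {k n} → k ≤ n → take k (applyUpTo f n) ≡ applyUpTo f k
  take-applyUpTo f {zero}           _         = refl
  take-applyUpTo f {suc k} {suc n} (s≤s k≤n) = cong (f 0 ∷_) (take-applyUpTo (f ∘ suc) k≤n)

  drop-applyUpTo : ∀ (f : ℕ → A) s n → drop s (applyUpTo f n) ≡ applyUpTo (f ∘ (s +_)) (n ∸ s)
  drop-applyUpTo f zero    n       = refl
  drop-applyUpTo f (suc s) zero    = refl
  drop-applyUpTo f (suc s) (suc n) = drop-applyUpTo (f ∘ suc) s n

  Unique-applyUpTo⁻ : ∀ {f : ℕ → A} n → Unique (applyUpTo f n) →
                      ∀ {s t} → s < n → t < n → f s ≡ f t → s ≡ t
  Unique-applyUpTo⁻ (suc n) _ {zero} {zero} _ _ _ = refl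
  Unique-applyUpTo⁻ (suc n) (f₀∉ ∷ _) {zero} {suc t} _ (s≤s t<n) f₀≡ =
    ⊥-elim (All.applyUpTo⁻ _ n f₀∉ t<n f₀≡)
  Unique-applyUpTo⁻ (suc n) (f₀∉ ∷ _) {suc s} {zero} (s≤s s<n) _ ≡f₀ =
    ⊥-elim (All.applyUpTo⁻ _ n f₀∉ s<n (sym ≡f₀))
  Unique-applyUpTo⁻ {f} (suc n) (_ ∷ u) {suc s} {suc t} (s≤s s<n) (s≤s t<n) eq =
    cong suc (Unique-applyUpTo⁻ {f ∘ suc} n u s<n t<n eq)

  toList∘tabulate : ∀ (f : ℕ → A) n → toList (tabulate {n = n} (f ∘ toℕ)) ≡ applyUpTo f n
  toList∘tabulate f zero    = refl
  toList∘tabulate f (suc n) = cong (f 0 ∷_) (toList∘tabulate (f ∘ suc) n)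

  cycPairs-applyUpTo : ∀ (f : ℕ → A) m → f (suc m) ≡ f 0 →
                       cycPairs (applyUpTo f (suc m)) ≡ applyUpTo (λ t → f t , f (suc t)) (suc m)
  cycPairs-applyUpTo f m closed =
    trans (cong (λ x → zip (f 0 ∷ applyUpTo (f ∘ suc) m) (applyUpTo (f ∘ suc) m ∷ʳ x)) (sym closed))
          (zip-shift f m)
    where
    zip-shift : ∀ (f : ℕ → A) m → zip (f 0 ∷ applyUpTo (f ∘ suc) m) (applyUpTo (f ∘ suc) m ∷ʳ f (suc m))
                                  ≡ applyUpTo (λ t → f t , f (suc t)) (suc m)
    zip-shift f zero    = refl
    zip-shift f (suc m) = cong ((f 0 , f 1) ∷_) (zip-shift (f ∘ suc) m)

module Modular (m : ℕ) where

  n : ℕ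
  n = suc m

  infix 4 _≡ₙ_
  _≡ₙ_ : ℕ → ℕ → Set
  a ≡ₙ b = a % n ≡ b % n

  %-≡ₙ : ∀ a → a % n ≡ₙ a
  %-≡ₙ a = m%n%n≡m%n a n

  <n-≡ₙ⇒≡ : ∀ {a b} → a < n → b < n → a ≡ₙ b → a ≡ b
  <n-≡ₙ⇒≡ a<n b<n a≡b = trans (sym (m<n⇒m%n≡m a<n)) (trans a≡b (m<n⇒m%n≡m b<n))

  +-congʳ-≡ₙ : ∀ a b c → a ≡ₙ b → a + c ≡ₙ b + c
  +-congʳ-≡ₙ a b c a≡b =
    trans (%-distribˡ-+ a c n) (trans (cong (λ x → (x + c % n) % n) a≡b) (sym (%-distribˡ-+ b c n)))

  +-congˡ-≡ₙ : ∀ a b c → a ≡ₙ b → c + a ≡ₙ c + b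
  +-congˡ-≡ₙ a b c a≡b =
    trans (cong (_% n) (+-comm c a)) (trans (+-congʳ-≡ₙ a b c a≡b) (cong (_% n) (+-comm b c)))

  *-congˡ-≡ₙ : ∀ a b c → a ≡ₙ b → c * a ≡ₙ c * b
  *-congˡ-≡ₙ a b c a≡b =
    trans (%-distribˡ-* c a n) (trans (cong (λ x → (c % n * x) % n) a≡b) (sym (%-distribˡ-* c b n)))

  +n-≡ₙ : ∀ a → a + n ≡ₙ a
  +n-≡ₙ a = [m+n]%n≡m%n a n

  +kn-≡ₙ : ∀ a k → a + k * n ≡ₙ a
  +kn-≡ₙ a k = [m+kn]%n≡m%n a k n

  private
    [r+x]+m*r≡x+r*n : ∀ r x → r + x + m * r ≡ x + r * n
    [r+x]+m*r≡x+r*n r x = solve 3 (λ r x m → r :+ x :+ m :* r := x :+ r :* (con 1 :+ m)) refl r x m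
      where open +-*-Solver

  +-cancelˡ-≡ₙ : ∀ r a b → r + a ≡ₙ r + b → a ≡ₙ b
  +-cancelˡ-≡ₙ r a b r+a≡r+b = begin
    a % n                   ≡⟨ +kn-≡ₙ a r ⟨
    (a + r * n) % n         ≡⟨ cong (_% n) ([r+x]+m*r≡x+r*n r a) ⟨
    (r + a + m * r) % n     ≡⟨ +-congʳ-≡ₙ (r + a) (r + b) (m * r) r+a≡r+b ⟩
    (r + b + m * r) % n     ≡⟨ cong (_% n) ([r+x]+m*r≡x+r*n r b) ⟩
    (b + r * n) % n         ≡⟨ +kn-≡ₙ b r ⟩
    b % n                   ∎
    where open ≡-Reasoning

  -- m ≡ -1 (mod n)
  m*[m*x]≡ₙx : ∀ x → m * (m * x) ≡ₙ x
  m*[m*x]≡ₙx x = begin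
    m * (m * x) % n               ≡⟨ +kn-≡ₙ (m * (m * x)) x ⟨
    (m * (m * x) + x * n) % n     ≡⟨ cong (_% n) (solve 2 (λ m x → m :* (m :* x) :+ x :* (con 1 :+ m) := x :+ (m :* x) :* (con 1 :+ m)) refl m x) ⟩
    (x + m * x * n) % n           ≡⟨ +kn-≡ₙ x (m * x) ⟩
    x % n                         ∎
    where
    open ≡-Reasoning
    open +-*-Solver

  toℕ-mod : ∀ t → toℕ (t mod n) ≡ t % n
  toℕ-mod t = toℕ-fromℕ< (m%n<n t n)

  mod-<n : ∀ {t} → t < n → toℕ (t mod n) ≡ t
  mod-<n {t} t<n = trans (toℕ-mod t) (m<n⇒m%n≡m t<n)

  module _ {A : Set} where

    periodic : Vec A n → ℕ → A
    periodic w t = lookup w (t mod n)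

    periodic-≡ₙ : ∀ (w : Vec A n) a b → a ≡ₙ b → periodic w a ≡ periodic w b
    periodic-≡ₙ w a b a≡b =
      cong (lookup w) (toℕ-injective (trans (toℕ-mod a) (trans a≡b (sym (toℕ-mod b)))))

    periodic-<n : ∀ (f : ℕ → A) {t} → t < n → periodic (tabulate (f ∘ toℕ)) t ≡ f t
    periodic-<n f {t} t<n = trans (lookup∘tabulate (f ∘ toℕ) (t mod n)) (cong f (mod-<n t<n))

    tabulate-periodic : ∀ (w : Vec A n) → tabulate (periodic w ∘ toℕ) ≡ w
    tabulate-periodic w = trans (tabulate-cong (λ i → cong (lookup w) (toℕ-injective (mod-<n (toℕ<n i))))) (tabulate∘lookup w)

    toList-periodic : ∀ (w : Vec A n) → toList w ≡ applyUpTo (periodic w) n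
    toList-periodic w = trans (cong toList (sym (tabulate-periodic w))) (toList∘tabulate (periodic w) n)

module Walks (ℓ′ : ℕ) (1≤ℓ′ : 1 ≤ ℓ′) where

  ℓ : ℕ
  ℓ = suc ℓ′

  -- chosen so that n = suc m is 2 * ℓ by normalisation
  m : ℕ
  m = ℓ′ + suc (ℓ′ + 0)

  open Modular m public

  letter : Word ℓ → ℕ → Fin ℓ
  letter = periodic

  segment : Word ℓ → ℕ → ℕ → List (Fin ℓ)
  segment word s k = applyUpTo (letter word ∘ (s +_)) k

  walk : Vtx ℓ → Word ℓ → ℕ → Vtx ℓ
  walk v word t = flips (applyUpTo (letter word) t) v

  module _ (v : Vtx ℓ) (word : Word ℓ) where

    walk-suc : ∀ t → walk v word (suc t) ≡ flipAt (letter word t) (walk v word t)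
    walk-suc t = trans (cong (λ L → flips L v) (sym (applyUpTo-∷ʳ (letter word) t)))
                       (flips-++ (applyUpTo (letter word) t) _ v)

    walk-+ : ∀ s k → walk v word (s + k) ≡ flips (segment word s k) (walk v word s)
    walk-+ s k = trans (cong (λ L → flips L v) (applyUpTo-+ (letter word) s k))
                       (flips-++ (applyUpTo (letter word) s) _ v)

    walk-returns⇒AllEven : ∀ s k → walk v word (s + k) ≡ walk v word s → AllEven (segment word s k)
    walk-returns⇒AllEven s k returns = flips-fixed⇒AllEven (segment word s k) (walk v word s) (trans (sym (walk-+ s k)) returns)

    AllEven⇒walk-returns : ∀ s k → AllEven (segment word s k) → walk v word (s + k) ≡ walk v word s
    AllEven⇒walk-returns s k even = trans (walk-+ s k) (AllEven⇒flips-fixed (segment word s k) (walk v word s) even)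

  segment-interval : ∀ (word : Word ℓ) s k → s + k ≤ n → take k (drop s (toList word)) ≡ segment word s k
  segment-interval word s k s+k≤n = begin
    take k (drop s (toList word))                         ≡⟨ cong (take k ∘ drop s) (toList-periodic word) ⟩
    take k (drop s (applyUpTo (letter word) n))           ≡⟨ cong (take k) (drop-applyUpTo (letter word) s n) ⟩
    take k (applyUpTo (letter word ∘ (s +_)) (n ∸ s))     ≡⟨ take-applyUpTo _ (subst (_≤ n ∸ s) (m+n∸m≡n s k) (∸-monoˡ-≤ s s+k≤n)) ⟩
    segment word s k                                      ∎
    where open ≡-Reasoning

  -- NoEvenInterval with positions and half-lengths in ℕ.
  NoEvenSegment : Word ℓ → Set
  NoEvenSegment word = ∀ s q → 1 ≤ q → q < ℓ → s + 2 * q ≤ n → ¬ AllEven (segment word s (2 * q))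

  NoEvenInterval⇒NoEvenSegment : ∀ {word} → NoEvenInterval word → NoEvenSegment word
  NoEvenInterval⇒NoEvenSegment {word} noEven s q 1≤q q<ℓ s+2q≤n even =
    noEven (fromℕ< q<ℓ) (fromℕ< s<1+n) (subst (1 ≤_) (sym q≡) 1≤q)
      (subst₂ (λ a b → a + 2 * b ≤ n) (sym s≡) (sym q≡) s+2q≤n)
      (subst AllEven (sym (trans (cong₂ (λ a b → take (2 * a) (drop b (toList word))) q≡ s≡)
                                 (segment-interval word s (2 * q) s+2q≤n))) even)
    where
    s<1+n : s < suc n
    s<1+n = s≤s (≤-trans (m≤m+n s (2 * q)) s+2q≤n)
    q≡ = toℕ-fromℕ< q<ℓ
    s≡ = toℕ-fromℕ< s<1+n

  NoEvenSegment⇒NoEvenInterval : ∀ {word} → NoEvenSegment word → NoEvenInterval word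
  NoEvenSegment⇒NoEvenInterval {word} noEven k s 1≤k s+2k≤n even =
    noEven (toℕ s) (toℕ k) 1≤k (toℕ<n k) s+2k≤n (subst AllEven (segment-interval word (toℕ s) (2 * toℕ k) s+2k≤n) even)

  module _ (v : Vtx ℓ) (word : Word ℓ) where

    walk-closed : EachTwice word → walk v word n ≡ v
    walk-closed twice = AllEven⇒walk-returns v word 0 n λ a →
      subst (λ L → 2 ∣ occ a L) (toList-periodic word) (subst (2 ∣_) (sym (twice a)) (divides 1 refl))

    private
      no-return : NoEvenSegment word → ∀ {s t} → s < t → t < n → walk v word s ≢ walk v word t
      no-return noEven {s} {t} s<t t<n walks≡t = odd-length (AllEven⇒even-length (segment word s k) even)
        where
        k = t ∸ s
        s+k≡t : s + k ≡ t
        s+k≡t = m+[n∸m]≡n (<⇒≤ s<t)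
        even : AllEven (segment word s k)
        even = walk-returns⇒AllEven v word s k (trans (cong (walk v word) s+k≡t) (sym walks≡t))
        odd-length : ¬ 2 ∣ length (segment word s k)
        odd-length (divides q |seg|≡q*2) =
          noEven s q 1≤q q<ℓ (subst (λ j → s + j ≤ n) k≡2q (≤-trans (≤-reflexive s+k≡t) (<⇒≤ t<n)))
                 (subst (AllEven ∘ segment word s) k≡2q even)
          where
          k≡2q : k ≡ 2 * q
          k≡2q = trans (sym (length-applyUpTo _ k)) (trans |seg|≡q*2 (*-comm q 2))
          1≤q : 1 ≤ q
          1≤q = n≢0⇒n>0 λ { refl → <⇒≢ (m<n⇒0<n∸m s<t) (sym k≡2q) }
          q<ℓ : q < ℓ
          q<ℓ = *-cancelˡ-< 2 q ℓ (subst (_< n) k≡2q (≤-<-trans (m∸n≤m t s) t<n))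

    InZ⇒walk-injective : InZ word → ∀ {s t} → s < n → t < n → walk v word s ≡ walk v word t → s ≡ t
    InZ⇒walk-injective (_ , noEven) {s} {t} s<n t<n walks≡t with <-cmp s t
    ... | tri< s<t _ _ = ⊥-elim (no-return (NoEvenInterval⇒NoEvenSegment noEven) s<t t<n walks≡t)
    ... | tri≈ _ s≡t _ = s≡t
    ... | tri> _ _ t<s = ⊥-elim (no-return (NoEvenInterval⇒NoEvenSegment noEven) t<s s<n (sym walks≡t))

  Adj : List (Edge ℓ) → Vtx ℓ → Vtx ℓ → Set
  Adj S a b = Any (λ e → Joins e a b) S

  record Traverses (S : List (Edge ℓ)) (g : ℕ → Vtx ℓ) : Set where
    field
      injective : ∀ {s t} → s < n → t < n → g s ≡ g t → s ≡ t
      closed    : g n ≡ g 0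
      step      : ∀ {t} → t < n → Adj S (g t) (g (suc t))
      covered   : ∀ {e} → e ∈ S → ∃ λ t → t < n × Joins e (g t) (g (suc t))

  closedWalk : (ℕ → Vtx ℓ) → Vec (Vtx ℓ) n
  closedWalk g = tabulate (g ∘ toℕ)

  Traverses⇒IsCycleWalk : ∀ {S g} → Traverses S g → IsCycleWalk n S (closedWalk g)
  Traverses⇒IsCycleWalk {S} {g} trav =
      subst Unique (sym (toList∘tabulate g n))
        (Unique.applyUpTo⁺₁ g n (λ i<j j<n eq → <⇒≢ i<j (injective (<-trans i<j j<n) j<n eq)))
    , subst (All (λ p → Adj S (proj₁ p) (proj₂ p))) (sym pairs≡) (All.applyUpTo⁺₁ (λ t → g t , g (suc t)) n step)
    , All.tabulate (λ e∈ → let t , t<n , J = covered e∈ in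
        subst (Any (λ p → Joins _ (proj₁ p) (proj₂ p))) (sym pairs≡) (Any.applyUpTo⁺ (λ t → g t , g (suc t)) J t<n))
    where
    open Traverses trav
    pairs≡ : cycPairs (toList (closedWalk g)) ≡ applyUpTo (λ t → g t , g (suc t)) n
    pairs≡ = trans (cong cycPairs (toList∘tabulate g n)) (cycPairs-applyUpTo g m closed)

  Generates : List (Edge ℓ) → Vtx ℓ × Word ℓ → Set
  Generates S (v , word) = IsCycleWalk n S (closedWalk (walk v word))

  generates? : ∀ S y → Dec (Generates S y)
  generates? S (v , word) = isCycleWalk? n S (closedWalk (walk v word))

  Adj⇒flipAt : ∀ {S a b} → Adj S a b → ∃ λ i → b ≡ flipAt i a
  Adj⇒flipAt adj with find adj
  ... | (_ , i) , _ , J = i , Joins⇒flipAt J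

  stepCoord : (ℕ → Vtx ℓ) → ℕ → Fin ℓ
  stepCoord g t = fromMaybe Fin.zero (flipCoord (g t) (g (suc t)))

  stepCoord-flipAt : ∀ {g t i} → g (suc t) ≡ flipAt i (g t) → stepCoord g t ≡ i
  stepCoord-flipAt {g} {t} {i} eq =
    cong (fromMaybe Fin.zero) (trans (cong (flipCoord (g t)) eq) (flipCoord-flipAt i (g t)))

  wordAlong : (ℕ → Vtx ℓ) → Word ℓ
  wordAlong g = tabulate (stepCoord g ∘ toℕ)

  module _ {S g} (trav : Traverses S g) where

    open Traverses trav

    walk-wordAlong : ∀ {t} → t ≤ n → walk (g 0) (wordAlong g) t ≡ g t
    walk-wordAlong {zero}  _   = refl
    walk-wordAlong {suc t} t<n with Adj⇒flipAt (step t<n)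
    ... | i , g[1+t]≡ = begin
      walk (g 0) (wordAlong g) (suc t)                               ≡⟨ walk-suc (g 0) (wordAlong g) t ⟩
      flipAt (letter (wordAlong g) t) (walk (g 0) (wordAlong g) t)   ≡⟨ cong₂ flipAt letter≡i (walk-wordAlong (<⇒≤ t<n)) ⟩
      flipAt i (g t)                                                 ≡⟨ g[1+t]≡ ⟨
      g (suc t)                                                      ∎
      where
      open ≡-Reasoning
      letter≡i : letter (wordAlong g) t ≡ i
      letter≡i = trans (periodic-<n (stepCoord g) t<n) (stepCoord-flipAt {g} g[1+t]≡)

    private
      letters : toList (wordAlong g) ≡ applyUpTo (stepCoord g) n
      letters = toList∘tabulate (stepCoord g) n

      wordAlong-AllEven : AllEven (toList (wordAlong g))
      wordAlong-AllEven = subst AllEven (sym (toList-periodic (wordAlong g)))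
        (walk-returns⇒AllEven (g 0) (wordAlong g) 0 n (trans (walk-wordAlong ≤-refl) closed))

      ∈-wordAlong : UsesAllCoords S → ∀ a → a ∈ toList (wordAlong g)
      ∈-wordAlong uses a with find (uses a)
      ... | (_ , i) , e∈ , refl with covered e∈
      ... | t , t<n , J = subst (i ∈_) (sym letters)
        (subst (_∈ applyUpTo (stepCoord g) n) (stepCoord-flipAt {g} (Joins⇒flipAt J)) (∈-applyUpTo⁺ (stepCoord g) t<n))

    wordAlong-EachTwice : UsesAllCoords S → EachTwice (wordAlong g)
    wordAlong-EachTwice uses = ∑-tight (λ a → occ a L)
      (λ a → positive-even⇒≥2 (∈⇒occ-pos (∈-wordAlong uses a)) (wordAlong-AllEven a))
      (trans (∑-occ L) (trans (cong length letters) (trans (length-applyUpTo (stepCoord g) n) (*-comm 2 ℓ))))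
      where
      L = toList (wordAlong g)
      positive-even⇒≥2 : ∀ {x} → 1 ≤ x → 2 ∣ x → 2 ≤ x
      positive-even⇒≥2 1≤x (divides (suc q) refl) = s≤s (s≤s z≤n)

    wordAlong-NoEvenSegment : NoEvenSegment (wordAlong g)
    wordAlong-NoEvenSegment s q 1≤q q<ℓ s+2q≤n even = [ returns-early , returns-at-end ]′ (m≤n⇒m<n∨m≡n s+2q≤n)
      where
      s<s+2q : s < s + 2 * q
      s<s+2q = m<m+n s (≤-trans (s≤s z≤n) (*-monoʳ-≤ 2 1≤q))
      g-returns : g s ≡ g (s + 2 * q)
      g-returns = trans (sym (walk-wordAlong (≤-trans (m≤m+n s (2 * q)) s+2q≤n)))
                        (trans (sym (AllEven⇒walk-returns (g 0) (wordAlong g) s (2 * q) even)) (walk-wordAlong s+2q≤n))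
      returns-early : s + 2 * q < n → ⊥
      returns-early s+2q<n = <⇒≢ s<s+2q (injective (<-trans s<s+2q s+2q<n) s+2q<n g-returns)
      returns-at-end : s + 2 * q ≡ n → ⊥
      returns-at-end s+2q≡n = <⇒≢ q<ℓ (*-cancelˡ-≡ q ℓ 2 (trans (cong (_+ 2 * q) (sym s≡0)) s+2q≡n))
        where
        s≡0 : s ≡ 0
        s≡0 = injective (subst (s <_) s+2q≡n s<s+2q) (s≤s z≤n) (trans g-returns (trans (cong g s+2q≡n) closed))

    wordAlong-InZ : UsesAllCoords S → InZ (wordAlong g)
    wordAlong-InZ uses = wordAlong-EachTwice uses , NoEvenSegment⇒NoEvenInterval wordAlong-NoEvenSegment

    Traverses⇒Generates : Generates S (g 0 , wordAlong g)
    Traverses⇒Generates = subst (IsCycleWalk n S)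
      (tabulate-cong (λ i → sym (walk-wordAlong (<⇒≤ (toℕ<n i))))) (Traverses⇒IsCycleWalk trav)

  Generates⇒Traverses : ∀ {S v word} → InZ word → Generates S (v , word) → Traverses S (walk v word)
  Generates⇒Traverses {S} {v} {word} inZ (_ , steps , edges) = record
    { injective = InZ⇒walk-injective v word inZ
    ; closed    = walk-closed v word (proj₁ inZ)
    ; step      = All.applyUpTo⁻ (λ t → u t , u (suc t)) n (subst (All (λ p → Adj S (proj₁ p) (proj₂ p))) pairs≡ steps)
    ; covered   = λ e∈ → Any.applyUpTo⁻ (λ t → u t , u (suc t))
                    (subst (Any (λ p → Joins _ (proj₁ p) (proj₂ p))) pairs≡ (All.lookup edges e∈))
    }
    where
    u = walk v word
    pairs≡ : cycPairs (toList (closedWalk u)) ≡ applyUpTo (λ t → u t , u (suc t)) n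
    pairs≡ = trans (cong cycPairs (toList∘tabulate u n)) (cycPairs-applyUpTo u m (walk-closed v word (proj₁ inZ)))

  steps : (ℕ → Vtx ℓ) → List (Vtx ℓ × Vtx ℓ)
  steps g = applyUpTo (λ t → g t , g (suc t)) n

  JoinsStep : (ℕ → Vtx ℓ) → Edge ℓ → Set
  JoinsStep g e = Any (λ p → Joins e (proj₁ p) (proj₂ p)) (steps g)

  joinsStep? : ∀ g → Decidable (JoinsStep g)
  joinsStep? g e = any? (λ p → joins? e (proj₁ p) (proj₂ p)) (steps g)

  edgesAlong : (ℕ → Vtx ℓ) → List (Edge ℓ)
  edgesAlong g = filter (joinsStep? g) (edgesQ ℓ)

  module _ {S g} (trav : Traverses S g) where

    open Traverses trav

    ∈⇒JoinsStep : ∀ {e} → e ∈ S → JoinsStep g e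
    ∈⇒JoinsStep e∈ = let t , t<n , J = covered e∈ in Any.applyUpTo⁺ (λ t → g t , g (suc t)) J t<n

    JoinsStep⇒∈ : (∀ {e} → e ∈ S → e ∈ edgesQ ℓ) → ∀ {e} → e ∈ edgesQ ℓ → JoinsStep g e → e ∈ S
    JoinsStep⇒∈ S⊆Q {v , i} e∈Q joins with Any.applyUpTo⁻ (λ t → g t , g (suc t)) joins
    ... | t , t<n , J with find (step t<n)
    ... | (v′ , i′) , e′∈S , J′ =
      subst (_∈ S) (sym (Joins-injective (∈-edgesQ⁻ e∈Q) (∈-edgesQ⁻ (S⊆Q e′∈S)) J J′)) e′∈S

  traversed-unique : ∀ {S S′ g} → Traverses S g → Traverses S′ g →
                     S ∈ subsets (edgesQ ℓ) → S′ ∈ subsets (edgesQ ℓ) → S ≡ S′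
  traversed-unique trav trav′ S∈ S′∈ = subsets-extensional edgesQ-unique S∈ S′∈
    (λ e∈ → JoinsStep⇒∈ trav′ (∈-subsets⇒⊆ _ S′∈) (∈-subsets⇒⊆ _ S∈ e∈) (∈⇒JoinsStep trav e∈))
    (λ e∈ → JoinsStep⇒∈ trav (∈-subsets⇒⊆ _ S∈) (∈-subsets⇒⊆ _ S′∈ e∈) (∈⇒JoinsStep trav′ e∈))

  module _ {g : ℕ → Vtx ℓ} where

    edgesAlong-traversed :
      (∀ {s t} → s < n → t < n → g s ≡ g t → s ≡ t) → g n ≡ g 0 →
      (∀ t → g (suc t) ≡ flipAt (stepCoord g t) (g t)) → Traverses (edgesAlong g) g
    edgesAlong-traversed injective closed flipStep = record
      { injective = injective
      ; closed    = closed
      ; step      = λ {t} t<n → lose (∈-edgesAlong t<n) (subst (Joins _ (g t)) (sym (flipStep t)) (proj₁ (edgeAt-spec (g t) _)))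
      ; covered   = λ e∈ → Any.applyUpTo⁻ (λ t → g t , g (suc t)) (proj₂ (∈-filter⁻ (joinsStep? g) {xs = edgesQ ℓ} e∈))
      }
      where
      ∈-edgesAlong : ∀ {t} → t < n → edgeAt (g t) (stepCoord g t) ∈ edgesAlong g
      ∈-edgesAlong {t} t<n = ∈-filter⁺ (joinsStep? g) (proj₁ (proj₂ (edgeAt-spec (g t) (stepCoord g t))))
        (Any.applyUpTo⁺ (λ t → g t , g (suc t)) (subst (Joins _ (g t)) (sym (flipStep t)) (proj₁ (edgeAt-spec (g t) _))) t<n)

  3≤n : 3 ≤ n
  3≤n = s≤s (+-mono-≤ 1≤ℓ′ (s≤s z≤n))

  module _ {v : Vtx ℓ} {word : Word ℓ} (inZ : InZ word) where

    private
      u = walk v word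

      u-flipStep : ∀ t → u (suc t) ≡ flipAt (stepCoord u t) (u t)
      u-flipStep t = trans (walk-suc v word t) (cong (λ i → flipAt i (u t)) (sym (stepCoord-flipAt {u} {t} (walk-suc v word t))))

    walk-traverses : Traverses (edgesAlong u) u
    walk-traverses = edgesAlong-traversed (InZ⇒walk-injective v word inZ) (walk-closed v word (proj₁ inZ)) u-flipStep

    private
      edgesAlong-walk-UsesAllCoords : UsesAllCoords (edgesAlong u)
      edgesAlong-walk-UsesAllCoords a with ∈-applyUpTo⁻ (letter word) (subst (a ∈_) (toList-periodic word)
                                                   (occ-pos⇒∈ (toList word) (subst (1 ≤_) (sym (proj₁ inZ a)) (s≤s z≤n))))
      ... | t , t<n , refl with find (Traverses.step walk-traverses t<n)
      ... | (_ , i) , e∈ , J = lose e∈ (flipAt-injectiveˡ (u t) (trans (sym (Joins⇒flipAt J)) (walk-suc v word t)))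

    edgesAlong-walk-∈cycles : edgesAlong u ∈ cycles ℓ
    edgesAlong-walk-∈cycles = ∈-filter⁺ isTarget? (filter∈subsets (joinsStep? u) (edgesQ ℓ))
      ((3≤n , closedWalk u , Traverses⇒IsCycleWalk walk-traverses) , edgesAlong-walk-UsesAllCoords)

    generates-unique : ∀ {S} → S ∈ cycles ℓ → Generates S (v , word) → S ≡ edgesAlong u
    generates-unique S∈ gen = traversed-unique (Generates⇒Traverses inZ gen) walk-traverses
      (proj₁ (∈-filter⁻ isTarget? {xs = subsets (edgesQ ℓ)} S∈)) (filter∈subsets (joinsStep? u) (edgesQ ℓ))

  -- u cannot step back to G t, since it visits no vertex twice.
  traversal-determined : ∀ {S u} (G : ℕ → Vtx ℓ) → Traverses S u →
    (∀ t {b} → Adj S (G (suc t)) b → b ≡ G (suc (suc t)) ⊎ b ≡ G t) → G n ≡ G 0 →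
    u 0 ≡ G 0 → u 1 ≡ G 1 → ∀ {t} → t ≤ n → u t ≡ G t
  traversal-determined {S} {u} G trav neighbours G-closed u₀ u₁ {t} t≤n with m≤n⇒m<n∨m≡n t≤n
  ... | inj₁ t<n = agree-< t<n
    where
    open Traverses trav
    agree : ∀ {t} → suc t < n → u t ≡ G t × u (suc t) ≡ G (suc t)
    agree {zero}  _     = u₀ , u₁
    agree {suc t} t+2<n with agree (<-trans (n<1+n (suc t)) t+2<n)
    ... | u≡G , u′≡G′ with neighbours t (subst (λ x → Adj S x (u (suc (suc t)))) u′≡G′ (step (<-trans (n<1+n (suc t)) t+2<n)))
    ...   | inj₁ u″≡G″ = u′≡G′ , u″≡G″
    ...   | inj₂ u″≡G  = ⊥-elim (<⇒≢ (<-trans (n<1+n t) (n<1+n (suc t))) (sym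
            (injective t+2<n (<-trans (n<1+n t) (<-trans (n<1+n (suc t)) t+2<n)) (trans u″≡G (sym u≡G)))))
    agree-< : ∀ {t} → t < n → u t ≡ G t
    agree-< {zero}  _   = u₀
    agree-< {suc t} t<n = proj₂ (agree t<n)
  ... | inj₂ refl = trans (Traverses.closed trav) (trans u₀ (sym G-closed))

  walk-agrees⇒pair≡ : ∀ {v word} (G : ℕ → Vtx ℓ) → (∀ {t} → t ≤ n → walk v word t ≡ G t) → (v , word) ≡ (G 0 , wordAlong G)
  walk-agrees⇒pair≡ {v} {word} G agrees = cong₂ _,_ (agrees z≤n)
    (trans (sym (tabulate-periodic word)) (tabulate-cong λ i → letter≡ (toℕ<n i)))
    where
    letter≡ : ∀ {t} → t < n → letter word t ≡ stepCoord G t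
    letter≡ {t} t<n = sym (stepCoord-flipAt {G} {t}
      (trans (sym (agrees t<n)) (trans (walk-suc v word t) (cong (flipAt (letter word t)) (agrees (<⇒≤ t<n))))))

  module Cycle {S : List (Edge ℓ)} {w : Vec (Vtx ℓ) n} (cyc : IsCycleWalk n S w) where

    vertex : ℕ → Vtx ℓ
    vertex = periodic w

    vertex-≡ₙ : ∀ a b → a ≡ₙ b → vertex a ≡ vertex b
    vertex-≡ₙ = periodic-≡ₙ w

    private
      vertex-% : ∀ j → vertex (j % n) ≡ vertex j
      vertex-% j = vertex-≡ₙ (j % n) j (%-≡ₙ j)

      closed : vertex n ≡ vertex 0
      closed = vertex-≡ₙ n 0 (+n-≡ₙ 0)

      pairs≡ : cycPairs (toList w) ≡ steps vertex
      pairs≡ = trans (cong cycPairs (toList-periodic w)) (cycPairs-applyUpTo vertex m closed)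

    vertex-injective : ∀ {a b} → vertex a ≡ vertex b → a ≡ₙ b
    vertex-injective {a} {b} eq = Unique-applyUpTo⁻ {f = vertex} n (subst Unique (toList-periodic w) (proj₁ cyc))
      (m%n<n a n) (m%n<n b n) (trans (vertex-% a) (trans eq (sym (vertex-% b))))

    vertex-step : ∀ j → Adj S (vertex j) (vertex (suc j))
    vertex-step j = subst₂ (Adj S) (vertex-% j) (vertex-≡ₙ (suc (j % n)) (suc j) (+-congˡ-≡ₙ (j % n) j 1 (%-≡ₙ j)))
      (All.applyUpTo⁻ (λ t → vertex t , vertex (suc t)) n
        (subst (All (λ p → Adj S (proj₁ p) (proj₂ p))) pairs≡ (proj₁ (proj₂ cyc))) (m%n<n j n))

    vertex-covered : ∀ {e} → e ∈ S → ∃ λ j → Joins e (vertex j) (vertex (suc j))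
    vertex-covered e∈ with Any.applyUpTo⁻ (λ t → vertex t , vertex (suc t))
      (subst (Any (λ p → Joins _ (proj₁ p) (proj₂ p))) pairs≡ (All.lookup (proj₂ (proj₂ cyc)) e∈))
    ... | j , _ , J = j , J

    -- vertex (j + m) is the predecessor of vertex j.
    vertex-neighbours : ∀ {j b} → Adj S (vertex j) b → b ≡ vertex (suc j) ⊎ b ≡ vertex (j + m)
    vertex-neighbours {j} adj with find adj
    ... | e , e∈ , J with vertex-covered e∈
    ... | i , J′ with Joins-endpoints J J′
    ... | inj₁ (j≡i , b≡i+1) = inj₁ (trans b≡i+1 (vertex-≡ₙ (suc i) (suc j) (+-congˡ-≡ₙ i j 1 (sym (vertex-injective {j} {i} j≡i)))))
    ... | inj₂ (j≡i+1 , b≡i) = inj₂ (trans b≡i (vertex-≡ₙ i (j + m) (begin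
      i % n             ≡⟨ +n-≡ₙ i ⟨
      (i + n) % n       ≡⟨ cong (_% n) (+-suc i m) ⟩
      (suc i + m) % n   ≡⟨ +-congʳ-≡ₙ (suc i) j m (sym (vertex-injective {j} {suc i} j≡i+1)) ⟩
      (j + m) % n       ∎)))
      where open ≡-Reasoning

    forward : ℕ → ℕ → Vtx ℓ
    forward r t = vertex (r + t)

    backward : ℕ → ℕ → Vtx ℓ
    backward r t = vertex (r + m * t)

    private
      Adj-sym : ∀ {a b} → Adj S a b → Adj S b a
      Adj-sym = Any.map Joins-sym

      r+x+m*r≡ₙx : ∀ r x → r + x + m * r ≡ₙ x
      r+x+m*r≡ₙx r x = trans (cong (_% n) (solve 3 (λ r x m → r :+ x :+ m :* r := x :+ r :* (con 1 :+ m)) refl r x m)) (+kn-≡ₙ x r)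
        where open +-*-Solver

      backward-step : ∀ r t → suc (r + m * suc t) ≡ₙ r + m * t
      backward-step r t = trans
        (cong (_% n) (solve 3 (λ r t m → con 1 :+ (r :+ m :* (con 1 :+ t)) := r :+ m :* t :+ (con 1 :+ m)) refl r t m))
        (+n-≡ₙ (r + m * t))
        where open +-*-Solver

    forward-traverses : ∀ r → Traverses S (forward r)
    forward-traverses r = record
      { injective = λ {s} {t} s<n t<n eq → <n-≡ₙ⇒≡ s<n t<n (+-cancelˡ-≡ₙ r s t (vertex-injective {r + s} {r + t} eq))
      ; closed    = vertex-≡ₙ (r + n) (r + 0) (trans (+n-≡ₙ r) (cong (_% n) (sym (+-identityʳ r))))
      ; step      = λ {t} _ → subst (Adj S (vertex (r + t)) ∘ vertex) (sym (+-suc r t)) (vertex-step (r + t))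
      ; covered   = covered
      }
      where
      covered : ∀ {e} → e ∈ S → ∃ λ t → t < n × Joins e (forward r t) (forward r (suc t))
      covered e∈ with vertex-covered e∈
      ... | j , J = t , m%n<n (j + m * r) n , subst₂ (Joins _) (sym (vertex-≡ₙ (r + t) j r+t≡ₙj))
          (sym (vertex-≡ₙ (r + suc t) (suc j) (trans (cong (_% n) (+-suc r t)) (+-congˡ-≡ₙ (r + t) j 1 r+t≡ₙj)))) J
        where
        t = (j + m * r) % n
        r+t≡ₙj : r + t ≡ₙ j
        r+t≡ₙj = trans (+-congˡ-≡ₙ t (j + m * r) r (%-≡ₙ (j + m * r)))
                       (trans (cong (_% n) (sym (+-assoc r j (m * r)))) (r+x+m*r≡ₙx r j))

    backward-traverses : ∀ r → Traverses S (backward r)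
    backward-traverses r = record
      { injective = λ {s} {t} s<n t<n eq → <n-≡ₙ⇒≡ s<n t<n (trans (sym (m*[m*x]≡ₙx s)) (trans
          (*-congˡ-≡ₙ (m * s) (m * t) m (+-cancelˡ-≡ₙ r (m * s) (m * t) (vertex-injective {r + m * s} {r + m * t} eq)))
          (m*[m*x]≡ₙx t)))
      ; closed    = vertex-≡ₙ (r + m * n) (r + m * 0)
                      (trans (+kn-≡ₙ r m) (cong (_% n) (sym (trans (cong (r +_) (*-zeroʳ m)) (+-identityʳ r)))))
      ; step      = λ {t} _ → Adj-sym (subst (Adj S (vertex (r + m * suc t)))
                      (vertex-≡ₙ (suc (r + m * suc t)) (r + m * t) (backward-step r t)) (vertex-step (r + m * suc t)))
      ; covered   = covered
      }
      where
      covered : ∀ {e} → e ∈ S → ∃ λ t → t < n × Joins e (backward r t) (backward r (suc t))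
      covered e∈ with vertex-covered e∈
      ... | j , J = t , m%n<n t₀ n , subst₂ (Joins _) (sym (vertex-≡ₙ (r + m * t) (suc j) r+m*t≡ₙ1+j))
          (sym (vertex-≡ₙ (r + m * suc t) j r+m*[1+t]≡ₙj)) (Joins-sym J)
        where
        t₀ = m * suc j + r
        t = t₀ % n
        r+m*t≡ₙ1+j : r + m * t ≡ₙ suc j
        r+m*t≡ₙ1+j = begin
          (r + m * t) % n                      ≡⟨ +-congˡ-≡ₙ (m * t) (m * t₀) r (*-congˡ-≡ₙ t t₀ m (%-≡ₙ t₀)) ⟩
          (r + m * t₀) % n                     ≡⟨ cong (_% n) (solve 3 (λ r j m → r :+ m :* (m :* j :+ r) := m :* (m :* j) :+ (r :+ m :* r)) refl r (suc j) m) ⟩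
          (m * (m * suc j) + (r + m * r)) % n  ≡⟨ +-congʳ-≡ₙ (m * (m * suc j)) (suc j) (r + m * r) (m*[m*x]≡ₙx (suc j)) ⟩
          (suc j + (r + m * r)) % n            ≡⟨ cong (_% n) (sym (+-assoc (suc j) r (m * r))) ⟩
          (suc j + r + m * r) % n              ≡⟨ cong (λ x → (x + m * r) % n) (+-comm (suc j) r) ⟩
          (r + suc j + m * r) % n              ≡⟨ r+x+m*r≡ₙx r (suc j) ⟩
          suc j % n                            ∎
          where
          open ≡-Reasoning
          open +-*-Solver
        r+m*[1+t]≡ₙj : r + m * suc t ≡ₙ j
        r+m*[1+t]≡ₙj = begin
          (r + m * suc t) % n   ≡⟨ cong (_% n) (solve 3 (λ r t m → r :+ m :* (con 1 :+ t) := r :+ m :* t :+ m) refl r t m) ⟩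
          (r + m * t + m) % n   ≡⟨ +-congʳ-≡ₙ (r + m * t) (suc j) m r+m*t≡ₙ1+j ⟩
          (suc j + m) % n       ≡⟨ cong (_% n) (sym (+-suc j m)) ⟩
          (j + n) % n           ≡⟨ +n-≡ₙ j ⟩
          j % n                 ∎
          where
          open ≡-Reasoning
          open +-*-Solver

    forwardPair backwardPair : ℕ → Vtx ℓ × Word ℓ
    forwardPair  r = forward r 0 , wordAlong (forward r)
    backwardPair r = backward r 0 , wordAlong (backward r)

    candidates : List (Vtx ℓ × Word ℓ)
    candidates = applyUpTo forwardPair n ++ applyUpTo backwardPair n

    private
      forward-0 : ∀ r → forward r 0 ≡ vertex r
      forward-0 r = cong vertex (+-identityʳ r)

      backward-0 : ∀ r → backward r 0 ≡ vertex r
      backward-0 r = cong vertex (trans (cong (r +_) (*-zeroʳ m)) (+-identityʳ r))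

      first-injective : ∀ {r r′} → r < n → r′ < n → vertex r ≡ vertex r′ → r ≡ r′
      first-injective {r} {r′} r<n r′<n eq = <n-≡ₙ⇒≡ r<n r′<n (vertex-injective {r} {r′} eq)

      2≤m : 2 ≤ m
      2≤m = +-mono-≤ 1≤ℓ′ (s≤s z≤n)

    candidates-unique : Unique candidates
    candidates-unique = Unique.++⁺
      (Unique.applyUpTo⁺₁ forwardPair n (λ {r} {r′} r<r′ r′<n eq → <⇒≢ r<r′ (first-injective (<-trans r<r′ r′<n) r′<n
        (trans (sym (forward-0 r)) (trans (cong proj₁ eq) (forward-0 r′))))))
      (Unique.applyUpTo⁺₁ backwardPair n (λ {r} {r′} r<r′ r′<n eq → <⇒≢ r<r′ (first-injective (<-trans r<r′ r′<n) r′<n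
        (trans (sym (backward-0 r)) (trans (cong proj₁ eq) (backward-0 r′))))))
      disjoint
      where
      -- equal candidates would give forward r 1 ≡ backward r 1, i.e. 1 ≡ m (mod n)
      disjoint : ∀ {y} → y ∈ applyUpTo forwardPair n × y ∈ applyUpTo backwardPair n → ⊥
      disjoint (y∈ , y∈′) with ∈-applyUpTo⁻ forwardPair y∈ | ∈-applyUpTo⁻ backwardPair y∈′
      ... | r , r<n , refl | r′ , r′<n , eq with first-injective r<n r′<n (trans (sym (forward-0 r)) (trans (cong proj₁ eq) (backward-0 r′)))
      ... | refl = <⇒≢ 2≤m 1≡m
        where
        steps-agree : vertex (r + 1) ≡ vertex (r + m * 1)
        steps-agree = trans (sym (walk-wordAlong (forward-traverses r) (s≤s z≤n)))
          (trans (cong (λ y → walk (proj₁ y) (proj₂ y) 1) eq) (walk-wordAlong (backward-traverses r) (s≤s z≤n)))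
        1≡m : 1 ≡ m
        1≡m = <n-≡ₙ⇒≡ (s≤s (≤-trans (s≤s z≤n) 2≤m)) ≤-refl
          (trans (+-cancelˡ-≡ₙ r 1 (m * 1) (vertex-injective {r + 1} {r + m * 1} steps-agree)) (cong (_% n) (*-identityʳ m)))

    candidates-generate : UsesAllCoords S → ∀ {y} → y ∈ candidates → y ∈ filter (generates? S) (pairs ℓ)
    candidates-generate uses y∈ = [ via forward-traverses , via backward-traverses ]′ (∈-++⁻ (applyUpTo forwardPair n) y∈)
      where
      via : ∀ {G : ℕ → ℕ → Vtx ℓ} → (∀ r → Traverses S (G r)) →
            ∀ {y} → y ∈ applyUpTo (λ r → G r 0 , wordAlong (G r)) n → y ∈ filter (generates? S) (pairs ℓ)
      via {G} trav y∈ =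
        let r , _ , y≡ = ∈-applyUpTo⁻ (λ r → G r 0 , wordAlong (G r)) y∈
        in subst (_∈ filter (generates? S) (pairs ℓ)) (sym y≡)
             (∈-filter⁺ (generates? S) {xs = pairs ℓ} (∈-pairs⁺ (wordAlong-InZ (trav r) uses)) (Traverses⇒Generates (trav r)))

    private
      forward-neighbours : ∀ r t {b} → Adj S (forward r (suc t)) b → b ≡ forward r (suc (suc t)) ⊎ b ≡ forward r t
      forward-neighbours r t adj with vertex-neighbours adj
      ... | inj₁ b≡ = inj₁ (trans b≡ (cong vertex (sym (+-suc r (suc t)))))
      ... | inj₂ b≡ = inj₂ (trans b≡ (vertex-≡ₙ (r + suc t + m) (r + t)
            (trans (cong (_% n) (solve 3 (λ r t m → r :+ (con 1 :+ t) :+ m := r :+ t :+ (con 1 :+ m)) refl r t m)) (+n-≡ₙ (r + t)))))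
        where open +-*-Solver

      backward-neighbours : ∀ r t {b} → Adj S (backward r (suc t)) b → b ≡ backward r (suc (suc t)) ⊎ b ≡ backward r t
      backward-neighbours r t adj with vertex-neighbours adj
      ... | inj₁ b≡ = inj₂ (trans b≡ (vertex-≡ₙ (suc (r + m * suc t)) (r + m * t) (backward-step r t)))
      ... | inj₂ b≡ = inj₁ (trans b≡ (cong vertex
            (solve 3 (λ r t m → r :+ m :* (con 1 :+ t) :+ m := r :+ m :* (con 2 :+ t)) refl r t m)))
        where open +-*-Solver

    private
      forward-start : ∀ {v word} → Traverses S (walk v word) → ∀ j →
                      v ≡ vertex j → walk v word 1 ≡ vertex (suc j) → (v , word) ≡ forwardPair (j % n)
      forward-start trav j v≡ u₁≡ = walk-agrees⇒pair≡ (forward r)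
        (traversal-determined (forward r) trav (forward-neighbours r) (Traverses.closed (forward-traverses r))
          (trans v≡ (vertex-≡ₙ j (r + 0) (sym (trans (cong (_% n) (+-identityʳ r)) (%-≡ₙ j)))))
          (trans u₁≡ (vertex-≡ₙ (suc j) (r + 1) (sym (trans (cong (_% n) (+-comm r 1)) (+-congˡ-≡ₙ r j 1 (%-≡ₙ j)))))))
        where r = j % n

      backward-start : ∀ {v word} → Traverses S (walk v word) → ∀ j →
                       v ≡ vertex (suc j) → walk v word 1 ≡ vertex j → (v , word) ≡ backwardPair (suc j % n)
      backward-start trav j v≡ u₁≡ = walk-agrees⇒pair≡ (backward r)
        (traversal-determined (backward r) trav (backward-neighbours r) (Traverses.closed (backward-traverses r))
          (trans v≡ (vertex-≡ₙ (suc j) (r + m * 0) (sym (trans (cong (_% n) r+m*0≡r) (%-≡ₙ (suc j))))))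
          (trans u₁≡ (vertex-≡ₙ j (r + m * 1) (sym r+m≡ₙj))))
        where
        r = suc j % n
        r+m*0≡r : r + m * 0 ≡ r
        r+m*0≡r = trans (cong (r +_) (*-zeroʳ m)) (+-identityʳ r)
        r+m≡ₙj : r + m * 1 ≡ₙ j
        r+m≡ₙj = begin
          (r + m * 1) % n   ≡⟨ +-congˡ-≡ₙ (m * 1) m r (cong (_% n) (*-identityʳ m)) ⟩
          (r + m) % n       ≡⟨ +-congʳ-≡ₙ r (suc j) m (%-≡ₙ (suc j)) ⟩
          (suc j + m) % n   ≡⟨ cong (_% n) (+-suc j m) ⟨
          (j + n) % n       ≡⟨ +n-≡ₙ j ⟩
          j % n             ∎
          where open ≡-Reasoning

    traversal∈candidates : ∀ {v word} → Traverses S (walk v word) → (v , word) ∈ candidates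
    traversal∈candidates trav with find (Traverses.step trav (s≤s z≤n))
    ... | _ , e∈ , J with vertex-covered e∈
    ... | j , J′ with Joins-endpoints J J′
    ... | inj₁ (v≡ , u₁≡) = ∈-++⁺ˡ
      (subst (_∈ applyUpTo forwardPair n) (sym (forward-start trav j v≡ u₁≡)) (∈-applyUpTo⁺ forwardPair (m%n<n j n)))
    ... | inj₂ (v≡ , u₁≡) = ∈-++⁺ʳ (applyUpTo forwardPair n)
      (subst (_∈ applyUpTo backwardPair n) (sym (backward-start trav j v≡ u₁≡)) (∈-applyUpTo⁺ backwardPair (m%n<n (suc j) n)))

    generators-count : UsesAllCoords S → length (filter (generates? S) (pairs ℓ)) ≡ n + n
    generators-count uses = trans
      (unique∧set⇒length≡ (Unique.filter⁺ (generates? S) pairs-unique) candidates-unique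
        (λ y∈ → let y∈pairs , gen = ∈-filter⁻ (generates? S) {xs = pairs ℓ} y∈
                in traversal∈candidates (Generates⇒Traverses (∈-pairs⁻ y∈pairs) gen))
        (candidates-generate uses))
      (trans (length-++ (applyUpTo forwardPair n)) (cong₂ _+_ (length-applyUpTo forwardPair n) (length-applyUpTo backwardPair n)))

  length-generators : ∀ {S} → S ∈ cycles ℓ → length (filter (generates? S) (pairs ℓ)) ≡ 4 * ℓ
  length-generators S∈ =
    let (_ , _ , cyc) , uses = proj₂ (∈-filter⁻ isTarget? {xs = subsets (edgesQ ℓ)} S∈)
    in trans (Cycle.generators-count cyc uses) (sym (*-distribʳ-+ ℓ 2 2))

  length-generated : ∀ {y} → y ∈ pairs ℓ → length (filter (λ S → generates? S y) (cycles ℓ)) ≡ 1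
  length-generated {v , word} y∈ = unique∧set⇒length≡
    (Unique.filter⁺ (λ S → generates? S (v , word)) (Unique.filter⁺ isTarget? (subsets-unique edgesQ-unique)))
    (All.[] ∷ AllPairs.[])
    (λ S∈ → let S∈cycles , gen = ∈-filter⁻ (λ S → generates? S (v , word)) {xs = cycles ℓ} S∈
            in here (generates-unique inZ S∈cycles gen))
    (λ { (here refl) → ∈-filter⁺ (λ S → generates? S (v , word))
                         (edgesAlong-walk-∈cycles inZ) (Traverses⇒IsCycleWalk (walk-traverses inZ)) })
    where
    inZ = ∈-pairs⁻ y∈

  zℓℓ-double-counting : zℓℓ ℓ * (4 * ℓ) ≡ cardZ ℓ * 2 ^ ℓ
  zℓℓ-double-counting = begin
    zℓℓ ℓ * (4 * ℓ)                                                               ≡⟨ cong (_* (4 * ℓ)) (zℓℓ≡length-cycles ℓ) ⟩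
    length (cycles ℓ) * (4 * ℓ)                                                   ≡⟨ sum-map-const (cycles ℓ) length-generators ⟨
    sum (map (λ S → length (filter (generates? S) (pairs ℓ))) (cycles ℓ))         ≡⟨ double-counting generates? (cycles ℓ) (pairs ℓ) ⟩
    sum (map (λ y → length (filter (λ S → generates? S y) (cycles ℓ))) (pairs ℓ)) ≡⟨ sum-map-const (pairs ℓ) length-generated ⟩
    length (pairs ℓ) * 1                                                          ≡⟨ *-identityʳ (length (pairs ℓ)) ⟩
    length (pairs ℓ)                                                              ≡⟨ length-pairs ℓ ⟩
    2 ^ ℓ * cardZ ℓ                                                               ≡⟨ *-comm (2 ^ ℓ) (cardZ ℓ) ⟩
    cardZ ℓ * 2 ^ ℓ                                                               ∎
    where open ≡-Reasoning

∑-const : ∀ k c → ∑ {k} (λ _ → c) ≡ k * c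
∑-const zero    c = refl
∑-const (suc k) c = cong (c +_) (∑-const k c)

∏-const : ∀ k c → ∏ {k} (λ _ → c) ≡ c ^ k
∏-const zero    c = refl
∏-const (suc k) c = cong (c *_) (∏-const k c)

cardZ-bound : ∀ ℓ → cardZ ℓ * 2 ^ ℓ ≤ (2 * ℓ) !
cardZ-bound ℓ = begin
  cardZ ℓ * 2 ^ ℓ                                 ≤⟨ *-monoˡ-≤ (2 ^ ℓ) (length-filter-mono inZ? (hasCounts? twice) proj₁ (vecsOver (allFin ℓ) (2 * ℓ))) ⟩
  wordsWithCounts (2 * ℓ) twice * 2 ^ ℓ           ≡⟨ cong (wordsWithCounts (2 * ℓ) twice *_) (∏-const ℓ 2) ⟨
  wordsWithCounts (2 * ℓ) twice * ∏ (λ a → twice a !) ≤⟨ wordsWithCounts-bound (2 * ℓ) twice (trans (∑-const ℓ 2) (*-comm ℓ 2)) ⟩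
  (2 * ℓ) !                                       ∎
  where
  open ≤-Reasoning
  twice : Fin ℓ → ℕ
  twice _ = 2

lemma5 : (ℓ : ℕ) → 4 ≤ ℓ →
         (zℓℓ ℓ * (4 * ℓ) ≡ cardZ ℓ * 2 ^ ℓ) × (zℓℓ ℓ * (4 * ℓ) ≤ (2 * ℓ) !)
lemma5 (suc ℓ′) (s≤s 3≤ℓ′) = counted , ≤-trans (≤-reflexive counted) (cardZ-bound (suc ℓ′))
  where
  counted = Walks.zℓℓ-double-counting ℓ′ (≤-trans (s≤s z≤n) 3≤ℓ′)
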